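{- Let $\Gamma$ be a set of first-order formulas of $\mathcal L_1$ and $A$ a first-order formula of $\mathcal L_1$, and let $k\in\{i,c\}$. If $\Gamma\vdash^1_k A$, then $\overline\Gamma\vdash^2_k\overline A$, where $\overline\Gamma=\{\overline F:F\in\Gamma\}$.
   Context: The second-order language $\mathcal L_2$ has: - logical symbols $\bot,\to,\wedge,\vee,\forall,\exists$; - a countable set $\mathcal V$ of first-order variables; - a countable set $\Sigma$ of function symbols, from which terms are built; - for each $n\in\mathbb N$, a countable set $\mathcal V_n$ of second-order variables of arity $n$. Its atomic formulas are $\bot$ and $X^n(t_1,\dots,t_n)$, with quantification over first- and second-order variables. The first-order language $\mathcal L_1$ has the same $\mathcal V$ and $\Sigma$ and, for each $n$, a relation symbol $\mathrm{Ap}_n$ of arity $n+1$ (and no others); its atomic formulas are $\bot$ and $\mathrm{Ap}_n(t,t_1,\dots,t_n)$. $\mathrm{Free}(F)$ denotes the set of free variables. $\Gamma\vdash^n_k F$ denotes natural-deduction derivability: - in first-order logic over $\mathcal L_1$ for $n=1$; - in second-order logic over $\mathcal L_2$ for $n=2$, where second-order instantiation is by arbitrary abstractions $\lambda x_1\dots x_n\,G$. The logic is intuitionistic for $k=i$ and classical for $k=c$. Fix for each $n$ a bijection $\phi_n:\mathcal V_n\to\mathcal V$. The reverse coding $F\mapsto\overline F$ ($\mathcal L_1\to\mathcal L_2$) is defined by: - $\overline\bot=\bot$; - $\overline{\mathrm{Ap}_n(x,t_1,\dots,t_n)}=X^n(t_1,\dots,t_n)$ with $X^n=\phi_n^{ -1}(x)$,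 when $x$ is a variable; - $\overline{\mathrm{Ap}_n(t,t_1,\dots,t_n)}=\bot$ when $t$ is not a variable; - $\overline{A\diamond B}=\overline A\diamond\overline B$ for $\diamond\in\{\to,\wedge,\vee\}$; - $\overline{Qx\,A}=Qx\,QX^{i_1}\dots QX^{i_p}\,\overline A$ for $Q\in\{\forall,\exists\}$, where $i_1<\dots<i_p$ and $\{X^{i_1},\dots,X^{i_p}\}$ is the set of those variables $\phi_n^{ -1}(x)$ ($n\in\mathbb N$) that occur free in $\overline A$. -}

module Defs where

open import Data.Nat using (ℕ; zero; suc; _⊔_; _≡ᵇ_)
open import Data.Bool using (Bool; true; false; _∧_; _∨_; not; if_then_else_; T)
open import Data.Vec using (Vec; []; _∷_)
open import Data.List using (List; []; _∷_; foldr; upTo; filterᵇ)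
open import Data.List.Membership.Propositional using (_∈_)
open import Data.Product using (Σ; _×_)
open import Data.Unit using (⊤)
open import Data.Empty using (⊥)
open import Function.Bundles using (_↣_; _↔_; Inverse)
open import Relation.Binary.PropositionalEquality using (_≡_; refl)
open import Relation.Nullary using (yes; no)
import Data.Nat as ℕ
open import Data.Vec using (map)

record Signature : Set₁ where
  field
    Fun       : Set
    arity     : Fun → ℕ
    countable : Fun ↣ ℕ

data Logic : Set where
  int cla : Logic

IsClassical : Logic → Set
IsClassical int = ⊥
IsClassical cla = ⊤

module Syntax (S : Signature) where
  open Signature S

  data Term : Set where
    var : ℕ → Term
    fun : (f : Fun) → Vec Term (arity f) → Term

  mutual
    occT : ℕ → Term → Bool
    occT x (var y)    = x ≡ᵇ y
    occT x (fun f ts) = occTs x ts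

    occTs : ∀ {n} → ℕ → Vec Term n → Bool
    occTs x []       = false
    occTs x (t ∷ ts) = occT x t ∨ occTs x ts

  Subst : Set
  Subst = ℕ → Term

  _[_↦_] : Subst → ℕ → Term → Subst
  (σ [ x ↦ t ]) y = if y ≡ᵇ x then t else σ y

  ι : Subst
  ι = var

  mutual
    substT : Subst → Term → Term
    substT σ (var x)    = σ x
    substT σ (fun f ts) = fun f (substTs σ ts)

    substTs : ∀ {n} → Subst → Vec Term n → Vec Term n
    substTs σ []       = []
    substTs σ (t ∷ ts) = substT σ t ∷ substTs σ ts

  -- L1: first-order language with relation symbols Ap_n of arity n+1.

  infixr 5 _⇒₁_
  data Form1 : Set where
    ⊥₁        : Form1
    Ap        : (n : ℕ) → Term → Vec Term n → Form1
    _⇒₁_ _∧₁_ _∨₁_ : Form1 → Form1 → Form1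
    ∀₁ ∃₁     : ℕ → Form1 → Form1

  ¬₁_ : Form1 → Form1
  ¬₁ A = A ⇒₁ ⊥₁

  free1 : ℕ → Form1 → Bool
  free1 x ⊥₁          = false
  free1 x (Ap n t ts) = occT x t ∨ occTs x ts
  free1 x (A ⇒₁ B)    = free1 x A ∨ free1 x B
  free1 x (A ∧₁ B)    = free1 x A ∨ free1 x B
  free1 x (A ∨₁ B)    = free1 x A ∨ free1 x B
  free1 x (∀₁ y A)    = not (x ≡ᵇ y) ∧ free1 x A
  free1 x (∃₁ y A)    = not (x ≡ᵇ y) ∧ free1 x A

  -- naive substitution (bound variables are not substituted)
  sub1 : Subst → Form1 → Form1
  sub1 σ ⊥₁          = ⊥₁
  sub1 σ (Ap n t ts) = Ap n (substT σ t) (substTs σ ts)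
  sub1 σ (A ⇒₁ B)    = sub1 σ A ⇒₁ sub1 σ B
  sub1 σ (A ∧₁ B)    = sub1 σ A ∧₁ sub1 σ B
  sub1 σ (A ∨₁ B)    = sub1 σ A ∨₁ sub1 σ B
  sub1 σ (∀₁ y A)    = ∀₁ y (sub1 (σ [ y ↦ var y ]) A)
  sub1 σ (∃₁ y A)    = ∃₁ y (sub1 (σ [ y ↦ var y ]) A)

  FreeFor1 : Subst → Form1 → Set
  FreeFor1 σ ⊥₁          = ⊤
  FreeFor1 σ (Ap n t ts) = ⊤
  FreeFor1 σ (A ⇒₁ B)    = FreeFor1 σ A × FreeFor1 σ B
  FreeFor1 σ (A ∧₁ B)    = FreeFor1 σ A × FreeFor1 σ B
  FreeFor1 σ (A ∨₁ B)    = FreeFor1 σ A × FreeFor1 σ B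
  FreeFor1 σ (∀₁ y A)    =
    FreeFor1 (σ [ y ↦ var y ]) A × (∀ z → T (free1 z (∀₁ y A)) → T (not (occT y (σ z))))
  FreeFor1 σ (∃₁ y A)    =
    FreeFor1 (σ [ y ↦ var y ]) A × (∀ z → T (free1 z (∃₁ y A)) → T (not (occT y (σ z))))

  NotFreeIn1 : ℕ → List Form1 → Set
  NotFreeIn1 x Δ = ∀ {B} → B ∈ Δ → T (not (free1 x B))

  data Der1 (k : Logic) : List Form1 → Form1 → Set where
    ax   : ∀ {Δ A} → A ∈ Δ → Der1 k Δ A
    ⊥E   : ∀ {Δ A} → Der1 k Δ ⊥₁ → Der1 k Δ A
    raa  : ∀ {Δ A} → IsClassical k → Der1 k (¬₁ A ∷ Δ) ⊥₁ → Der1 k Δ A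
    ⇒I   : ∀ {Δ A B} → Der1 k (A ∷ Δ) B → Der1 k Δ (A ⇒₁ B)
    ⇒E   : ∀ {Δ A B} → Der1 k Δ (A ⇒₁ B) → Der1 k Δ A → Der1 k Δ B
    ∧I   : ∀ {Δ A B} → Der1 k Δ A → Der1 k Δ B → Der1 k Δ (A ∧₁ B)
    ∧E₁  : ∀ {Δ A B} → Der1 k Δ (A ∧₁ B) → Der1 k Δ A
    ∧E₂  : ∀ {Δ A B} → Der1 k Δ (A ∧₁ B) → Der1 k Δ B
    ∨I₁  : ∀ {Δ A B} → Der1 k Δ A → Der1 k Δ (A ∨₁ B)
    ∨I₂  : ∀ {Δ A B} → Der1 k Δ B → Der1 k Δ (A ∨₁ B)
    ∨E   : ∀ {Δ A B C} → Der1 k Δ (A ∨₁ B) → Der1 k (A ∷ Δ) C → Der1 k (B ∷ Δ) C → Der1 k Δ C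
    ∀I   : ∀ {Δ A} x → NotFreeIn1 x Δ → Der1 k Δ A → Der1 k Δ (∀₁ x A)
    ∀E   : ∀ {Δ A x} t → FreeFor1 (ι [ x ↦ t ]) A → Der1 k Δ (∀₁ x A) → Der1 k Δ (sub1 (ι [ x ↦ t ]) A)
    ∃I   : ∀ {Δ A x} t → FreeFor1 (ι [ x ↦ t ]) A → Der1 k Δ (sub1 (ι [ x ↦ t ]) A) → Der1 k Δ (∃₁ x A)
    ∃E   : ∀ {Δ A C x} → Der1 k Δ (∃₁ x A) → Der1 k (A ∷ Δ) C →
           NotFreeIn1 x Δ → T (not (free1 x C)) → Der1 k Δ C

  -- Γ ⊢¹ₖ A for an arbitrary set Γ: derivable from finitely many members of Γ
  _⊢¹[_]_ : (Form1 → Set) → Logic → Form1 → Set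
  Γ ⊢¹[ k ] A = Σ (List Form1) λ Δ → (∀ {B} → B ∈ Δ → Γ B) × Der1 k Δ A

  -- L2: second-order language; X^n_i is (SV n i ·).

  infixr 5 _⇒₂_
  data Form2 : Set where
    ⊥₂        : Form2
    SV        : (n : ℕ) → ℕ → Vec Term n → Form2
    _⇒₂_ _∧₂_ _∨₂_ : Form2 → Form2 → Form2
    ∀ᵢ ∃ᵢ     : ℕ → Form2 → Form2
    ∀ₛ ∃ₛ     : (n : ℕ) → ℕ → Form2 → Form2

  ¬₂_ : Form2 → Form2
  ¬₂ A = A ⇒₂ ⊥₂

  free2 : ℕ → Form2 → Bool
  free2 x ⊥₂          = false
  free2 x (SV n i ts) = occTs x ts
  free2 x (A ⇒₂ B)    = free2 x A ∨ free2 x B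
  free2 x (A ∧₂ B)    = free2 x A ∨ free2 x B
  free2 x (A ∨₂ B)    = free2 x A ∨ free2 x B
  free2 x (∀ᵢ y A)    = not (x ≡ᵇ y) ∧ free2 x A
  free2 x (∃ᵢ y A)    = not (x ≡ᵇ y) ∧ free2 x A
  free2 x (∀ₛ m j A)  = free2 x A
  free2 x (∃ₛ m j A)  = free2 x A

  sameSV : ℕ → ℕ → ℕ → ℕ → Bool
  sameSV n i m j = (n ≡ᵇ m) ∧ (i ≡ᵇ j)

  freeSV : ℕ → ℕ → Form2 → Bool
  freeSV n i ⊥₂          = false
  freeSV n i (SV m j ts) = sameSV n i m j
  freeSV n i (A ⇒₂ B)    = freeSV n i A ∨ freeSV n i B
  freeSV n i (A ∧₂ B)    = freeSV n i A ∨ freeSV n i B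
  freeSV n i (A ∨₂ B)    = freeSV n i A ∨ freeSV n i B
  freeSV n i (∀ᵢ y A)    = freeSV n i A
  freeSV n i (∃ᵢ y A)    = freeSV n i A
  freeSV n i (∀ₛ m j A)  = not (sameSV n i m j) ∧ freeSV n i A
  freeSV n i (∃ₛ m j A)  = not (sameSV n i m j) ∧ freeSV n i A

  sub2 : Subst → Form2 → Form2
  sub2 σ ⊥₂          = ⊥₂
  sub2 σ (SV n i ts) = SV n i (substTs σ ts)
  sub2 σ (A ⇒₂ B)    = sub2 σ A ⇒₂ sub2 σ B
  sub2 σ (A ∧₂ B)    = sub2 σ A ∧₂ sub2 σ B
  sub2 σ (A ∨₂ B)    = sub2 σ A ∨₂ sub2 σ B
  sub2 σ (∀ᵢ y A)    = ∀ᵢ y (sub2 (σ [ y ↦ var y ]) A)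
  sub2 σ (∃ᵢ y A)    = ∃ᵢ y (sub2 (σ [ y ↦ var y ]) A)
  sub2 σ (∀ₛ m j A)  = ∀ₛ m j (sub2 σ A)
  sub2 σ (∃ₛ m j A)  = ∃ₛ m j (sub2 σ A)

  FreeFor2 : Subst → Form2 → Set
  FreeFor2 σ ⊥₂          = ⊤
  FreeFor2 σ (SV n i ts) = ⊤
  FreeFor2 σ (A ⇒₂ B)    = FreeFor2 σ A × FreeFor2 σ B
  FreeFor2 σ (A ∧₂ B)    = FreeFor2 σ A × FreeFor2 σ B
  FreeFor2 σ (A ∨₂ B)    = FreeFor2 σ A × FreeFor2 σ B
  FreeFor2 σ (∀ᵢ y A)    =
    FreeFor2 (σ [ y ↦ var y ]) A × (∀ z → T (free2 z (∀ᵢ y A)) → T (not (occT y (σ z))))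
  FreeFor2 σ (∃ᵢ y A)    =
    FreeFor2 (σ [ y ↦ var y ]) A × (∀ z → T (free2 z (∃ᵢ y A)) → T (not (occT y (σ z))))
  FreeFor2 σ (∀ₛ m j A)  = FreeFor2 σ A
  FreeFor2 σ (∃ₛ m j A)  = FreeFor2 σ A

  -- the substitution x₁ ↦ t₁, …, xₙ ↦ tₙ (for repeated xᵢ the last one wins,
  -- as in λx₁.….λxₙ.G)
  argSubst : ∀ {n} → Vec ℕ n → Vec Term n → Subst
  argSubst []       []       = ι
  argSubst (x ∷ xs) (t ∷ ts) y =
    if occT y (var x) ∧ not (occTs y (map var xs)) then t else argSubst xs ts y

  record Abs (n : ℕ) : Set where
    constructor ƛ
    field
      params : Vec ℕ n
      body   : Form2

  freeAbs : ∀ {n} → ℕ → Abs n → Bool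
  freeAbs y (ƛ xs G) = free2 y G ∧ not (occTs y (map var xs))

  inst : (n i : ℕ) → Abs n → Form2 → Form2
  inst n i L ⊥₂          = ⊥₂
  inst n i L (SV m j ts) with n ℕ.≟ m
  ... | yes refl =
        if i ≡ᵇ j then sub2 (argSubst (Abs.params L) ts) (Abs.body L) else SV m j ts
  ... | no _ = SV m j ts
  inst n i L (A ⇒₂ B)    = inst n i L A ⇒₂ inst n i L B
  inst n i L (A ∧₂ B)    = inst n i L A ∧₂ inst n i L B
  inst n i L (A ∨₂ B)    = inst n i L A ∨₂ inst n i L B
  inst n i L (∀ᵢ y A)    = ∀ᵢ y (inst n i L A)
  inst n i L (∃ᵢ y A)    = ∃ᵢ y (inst n i L A)
  inst n i L (∀ₛ m j A)  = if sameSV n i m j then ∀ₛ m j A else ∀ₛ m j (inst n i L A)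
  inst n i L (∃ₛ m j A)  = if sameSV n i m j then ∃ₛ m j A else ∃ₛ m j (inst n i L A)

  -- λxs.G is free for X^n_i in F: no capture of free variables of λxs.G by
  -- binders of F, and each G[ts/xs] is itself a capture-free substitution
  FreeForAbs : (n i : ℕ) → Abs n → Form2 → Set
  FreeForAbs n i L ⊥₂          = ⊤
  FreeForAbs n i L (SV m j ts) with n ℕ.≟ m
  ... | yes refl =
        if i ≡ᵇ j then FreeFor2 (argSubst (Abs.params L) ts) (Abs.body L) else ⊤
  ... | no _ = ⊤
  FreeForAbs n i L (A ⇒₂ B)    = FreeForAbs n i L A × FreeForAbs n i L B
  FreeForAbs n i L (A ∧₂ B)    = FreeForAbs n i L A × FreeForAbs n i L B
  FreeForAbs n i L (A ∨₂ B)    = FreeForAbs n i L A × FreeForAbs n i L B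
  FreeForAbs n i L (∀ᵢ y A)    =
    FreeForAbs n i L A × (T (freeSV n i A) → T (not (freeAbs y L)))
  FreeForAbs n i L (∃ᵢ y A)    =
    FreeForAbs n i L A × (T (freeSV n i A) → T (not (freeAbs y L)))
  FreeForAbs n i L (∀ₛ m j A)  =
    if sameSV n i m j then ⊤
    else (FreeForAbs n i L A × (T (freeSV n i A) → T (not (freeSV m j (Abs.body L)))))
  FreeForAbs n i L (∃ₛ m j A)  =
    if sameSV n i m j then ⊤
    else (FreeForAbs n i L A × (T (freeSV n i A) → T (not (freeSV m j (Abs.body L)))))

  NotFreeIn2 : ℕ → List Form2 → Set
  NotFreeIn2 x Δ = ∀ {B} → B ∈ Δ → T (not (free2 x B))

  NotFreeSVIn2 : ℕ → ℕ → List Form2 → Set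
  NotFreeSVIn2 n i Δ = ∀ {B} → B ∈ Δ → T (not (freeSV n i B))

  data Der2 (k : Logic) : List Form2 → Form2 → Set where
    ax   : ∀ {Δ A} → A ∈ Δ → Der2 k Δ A
    ⊥E   : ∀ {Δ A} → Der2 k Δ ⊥₂ → Der2 k Δ A
    raa  : ∀ {Δ A} → IsClassical k → Der2 k (¬₂ A ∷ Δ) ⊥₂ → Der2 k Δ A
    ⇒I   : ∀ {Δ A B} → Der2 k (A ∷ Δ) B → Der2 k Δ (A ⇒₂ B)
    ⇒E   : ∀ {Δ A B} → Der2 k Δ (A ⇒₂ B) → Der2 k Δ A → Der2 k Δ B
    ∧I   : ∀ {Δ A B} → Der2 k Δ A → Der2 k Δ B → Der2 k Δ (A ∧₂ B)
    ∧E₁  : ∀ {Δ A B} → Der2 k Δ (A ∧₂ B) → Der2 k Δ A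
    ∧E₂  : ∀ {Δ A B} → Der2 k Δ (A ∧₂ B) → Der2 k Δ B
    ∨I₁  : ∀ {Δ A B} → Der2 k Δ A → Der2 k Δ (A ∨₂ B)
    ∨I₂  : ∀ {Δ A B} → Der2 k Δ B → Der2 k Δ (A ∨₂ B)
    ∨E   : ∀ {Δ A B C} → Der2 k Δ (A ∨₂ B) → Der2 k (A ∷ Δ) C → Der2 k (B ∷ Δ) C → Der2 k Δ C
    ∀I   : ∀ {Δ A} x → NotFreeIn2 x Δ → Der2 k Δ A → Der2 k Δ (∀ᵢ x A)
    ∀E   : ∀ {Δ A x} t → FreeFor2 (ι [ x ↦ t ]) A → Der2 k Δ (∀ᵢ x A) → Der2 k Δ (sub2 (ι [ x ↦ t ]) A)
    ∃I   : ∀ {Δ A x} t → FreeFor2 (ι [ x ↦ t ]) A → Der2 k Δ (sub2 (ι [ x ↦ t ]) A) → Der2 k Δ (∃ᵢ x A)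
    ∃E   : ∀ {Δ A C x} → Der2 k Δ (∃ᵢ x A) → Der2 k (A ∷ Δ) C →
           NotFreeIn2 x Δ → T (not (free2 x C)) → Der2 k Δ C
    ∀²I  : ∀ {Δ A} n i → NotFreeSVIn2 n i Δ → Der2 k Δ A → Der2 k Δ (∀ₛ n i A)
    ∀²E  : ∀ {Δ A n i} (L : Abs n) → FreeForAbs n i L A → Der2 k Δ (∀ₛ n i A) → Der2 k Δ (inst n i L A)
    ∃²I  : ∀ {Δ A n i} (L : Abs n) → FreeForAbs n i L A → Der2 k Δ (inst n i L A) → Der2 k Δ (∃ₛ n i A)
    ∃²E  : ∀ {Δ A C n i} → Der2 k Δ (∃ₛ n i A) → Der2 k (A ∷ Δ) C →
           NotFreeSVIn2 n i Δ → T (not (freeSV n i C)) → Der2 k Δ C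

  _⊢²[_]_ : (Form2 → Set) → Logic → Form2 → Set
  Γ ⊢²[ k ] A = Σ (List Form2) λ Δ → (∀ {B} → B ∈ Δ → Γ B) × Der2 k Δ A

  -- The reverse coding F ↦ F̄, relative to bijections φₙ : 𝒱ₙ → 𝒱
  -- (φ n is a bijection ℕ ↔ ℕ; φₙ⁻¹ is Inverse.from (φ n)).

  module Coding (φ : (n : ℕ) → ℕ ↔ ℕ) where

    φ⁻¹ : ℕ → ℕ → ℕ
    φ⁻¹ n x = Inverse.from (φ n) x

    -- strict upper bound on arities of second-order variables in A
    arBound : Form2 → ℕ
    arBound ⊥₂          = 0
    arBound (SV n i ts) = suc n
    arBound (A ⇒₂ B)    = arBound A ⊔ arBound B
    arBound (A ∧₂ B)    = arBound A ⊔ arBound B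
    arBound (A ∨₂ B)    = arBound A ⊔ arBound B
    arBound (∀ᵢ y A)    = arBound A
    arBound (∃ᵢ y A)    = arBound A
    arBound (∀ₛ m j A)  = suc m ⊔ arBound A
    arBound (∃ₛ m j A)  = suc m ⊔ arBound A

    arities : ℕ → Form2 → List ℕ
    arities x A = filterᵇ (λ n → freeSV n (φ⁻¹ n x) A) (upTo (arBound A))

    quantSV : ((n : ℕ) → ℕ → Form2 → Form2) → ℕ → Form2 → Form2
    quantSV Q x A = foldr (λ n B → Q n (φ⁻¹ n x) B) A (arities x A)

    code : Form1 → Form2
    code ⊥₁                = ⊥₂
    code (Ap n (var x) ts) = SV n (φ⁻¹ n x) ts
    code (Ap n (fun f us) ts) = ⊥₂
    code (A ⇒₁ B)          = code A ⇒₂ code B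
    code (A ∧₁ B)          = code A ∧₂ code B
    code (A ∨₁ B)          = code A ∨₂ code B
    code (∀₁ x A)          = ∀ᵢ x (quantSV ∀ₛ x (code A))
    code (∃₁ x A)          = ∃ᵢ x (quantSV ∃ₛ x (code A))

    codeSet : (Form1 → Set) → Form2 → Set
    codeSet Γ G = Σ Form1 λ F → Γ F × (G ≡ code F)

-- A first-order ∀x A is coded as ∀x followed by a block of second-order ∀X^n over the
-- variables X^n = φₙ⁻¹(x) free in Ā, so ∀I and the propositional rules translate directly.
-- For ∀E with a term t, the first-order instance substitutes t only in argument positions:
-- the heads Ap n (x, …) of A became X^n(…).  Instantiating each X^n of the block with
-- λx⃗. Y^n(x⃗), Y^n = φₙ⁻¹(y), when t is a variable y, and with λx⃗. ⊥ otherwise, substitutes t into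
-- the heads of arity n; after the whole block the substitution A[t/x] has been carried out.
-- ∃I is dual, and ∃E eliminates the first-order and then each second-order ∃ of the block.

module Submission where

open import Defs
open import Data.Bool using (Bool; true; false; _∧_; _∨_; not; if_then_else_; T)
open import Data.Bool.Properties using (T-≡; T-not-≡; T-∨; ¬-not; ∨-zeroʳ; ∧-zeroʳ)
open import Data.Empty using (⊥-elim)
open import Data.List using (List; []; _∷_; [_]; _++_; _∷ʳ_; foldr; upTo; filterᵇ)
import Data.List as List
open import Data.List.Membership.Propositional using (_∈_)
open import Data.List.Membership.Propositional.Properties
  using (∈-map⁺; ∈-map⁻; ∈-filter⁺; ∈-upTo⁺)
open import Data.List.Properties using (filter-++; filter-≐; upTo-∷ʳ; ++-identityʳ)
open import Data.List.Relation.Unary.All using (All; []; _∷_; tabulate)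
import Data.List.Relation.Unary.All as All
open import Data.List.Relation.Unary.Any using (here; there)
open import Data.List.Relation.Unary.AllPairs using (_∷_)
open import Data.List.Relation.Unary.Unique.Propositional using (Unique)
import Data.List.Relation.Unary.Unique.Propositional.Properties as Unique
open import Data.Nat using (ℕ; zero; suc; _⊔_; _≡ᵇ_; _<_; _≤_; s≤s)
import Data.Nat as ℕ
open import Data.Nat.Properties
  using (≡ᵇ⇒≡; ≤-refl; ≤-trans; <⇒≢; <-irrefl; m≤n⇒m≤1+n; m≤m⊔n; m≤n⊔m;
         m≤n⇒m<n∨m≡n)
open import Data.Product using (_×_; _,_)
open import Data.Sum using (_⊎_; inj₁; inj₂)
import Data.Sum as Sum
open import Data.Unit using (tt)
open import Data.Vec using (Vec; []; _∷_; map)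
open import Function using (_∘_)
open import Function.Bundles using (_↔_; Inverse; Equivalence)
open import Relation.Binary.PropositionalEquality hiding ([_])
open import Relation.Nullary using (yes; no)
open import Relation.Nullary.Decidable using (T?)

open Equivalence using (to; from)

≡ᵇ-refl : ∀ n → (n ≡ᵇ n) ≡ true
≡ᵇ-refl zero    = refl
≡ᵇ-refl (suc n) = ≡ᵇ-refl n

≡ᵇ-true⇒≡ : ∀ {m n} → (m ≡ᵇ n) ≡ true → m ≡ n
≡ᵇ-true⇒≡ {m} {n} e = ≡ᵇ⇒≡ m n (from T-≡ e)

≢⇒≡ᵇ-false : ∀ {m n} → m ≢ n → (m ≡ᵇ n) ≡ false
≢⇒≡ᵇ-false m≢n = ¬-not (m≢n ∘ ≡ᵇ-true⇒≡)

≡ᵇ-sym : ∀ m n → (m ≡ᵇ n) ≡ (n ≡ᵇ m)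
≡ᵇ-sym zero    zero    = refl
≡ᵇ-sym zero    (suc n) = refl
≡ᵇ-sym (suc m) zero    = refl
≡ᵇ-sym (suc m) (suc n) = ≡ᵇ-sym m n

∧-proj₁ : ∀ {a b} → T (a ∧ b) → T a
∧-proj₁ {true} _ = tt

∧-proj₂ : ∀ {a b} → T (a ∧ b) → T b
∧-proj₂ {true} t = t

∨-false⁻ : ∀ {a b} → (a ∨ b) ≡ false → a ≡ false × b ≡ false
∨-false⁻ {false} {false} _ = refl , refl

∨-mono : ∀ {a b c d} → (T a → T c) → (T b → T d) → T (a ∨ b) → T (c ∨ d)
∨-mono {a} {b} {c} {d} f g = from (T-∨ {c} {d}) ∘ Sum.map f g ∘ to (T-∨ {a} {b})

∧-monoʳ : ∀ {a b c} → (T b → T c) → T (a ∧ b) → T (a ∧ c)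
∧-monoʳ {true} f = f

contraposeᵇ : ∀ {a b} → (T a → T b) → T (not b) → T (not a)
contraposeᵇ {false} f _  = tt
contraposeᵇ {true}  f ¬b = ⊥-elim (subst T (to T-not-≡ ¬b) (f tt))

filterᵇ-upTo-extend : (p : ℕ → Bool) {b c : ℕ} → (∀ m → T (p m) → m < b) → b ≤ c →
                      filterᵇ p (upTo b) ≡ filterᵇ p (upTo c)
filterᵇ-upTo-extend p {zero} {zero} p<b b≤c = refl
filterᵇ-upTo-extend p {b} {suc c} p<b b≤c with m≤n⇒m<n∨m≡n b≤c
... | inj₂ refl = refl
... | inj₁ (s≤s b≤c) = begin
  filterᵇ p (upTo b)                          ≡⟨ filterᵇ-upTo-extend p p<b b≤c ⟩
  filterᵇ p (upTo c)                          ≡⟨ sym (++-identityʳ _) ⟩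
  filterᵇ p (upTo c) ++ []                    ≡⟨ cong (filterᵇ p (upTo c) ++_) (sym last-rejected) ⟩
  filterᵇ p (upTo c) ++ filterᵇ p [ c ]       ≡⟨ sym (filter-++ (T? ∘ p) (upTo c) [ c ]) ⟩
  filterᵇ p (upTo c ∷ʳ c)                     ≡⟨ cong (filterᵇ p) (upTo-∷ʳ c) ⟩
  filterᵇ p (upTo (suc c))                    ∎
  where
  open ≡-Reasoning
  last-rejected : filterᵇ p [ c ] ≡ []
  last-rejected with p c in pc
  ... | false = refl
  ... | true  = ⊥-elim (<-irrefl refl (≤-trans (p<b c (from T-≡ pc)) b≤c))

module SyntaxProperties (S : Signature) where
  open Syntax S

  sameSV-refl : ∀ n i → sameSV n i n i ≡ true
  sameSV-refl n i rewrite ≡ᵇ-refl n | ≡ᵇ-refl i = refl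

  sameSV-sym : ∀ n i m j → sameSV n i m j ≡ sameSV m j n i
  sameSV-sym n i m j rewrite ≡ᵇ-sym n m | ≡ᵇ-sym i j = refl

  sameSV-true⁻ : ∀ n i m j → sameSV n i m j ≡ true → n ≡ m × i ≡ j
  sameSV-true⁻ n i m j e with n ≡ᵇ m in n≡ᵇm | i ≡ᵇ j in i≡ᵇj
  sameSV-true⁻ n i m j refl | true | true = ≡ᵇ-true⇒≡ n≡ᵇm , ≡ᵇ-true⇒≡ i≡ᵇj

  sameSV-false⁺ : ∀ n i m j → (n ≡ m → i ≢ j) → sameSV n i m j ≡ false
  sameSV-false⁺ n i m j ne with n ≡ᵇ m in n≡ᵇm
  ... | false = refl
  ... | true  = ≢⇒≡ᵇ-false (ne (≡ᵇ-true⇒≡ n≡ᵇm))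

  update-var-fixes : ∀ σ y z → σ z ≡ var z → (σ [ y ↦ var y ]) z ≡ var z
  update-var-fixes σ y z σz with z ≡ᵇ y in z≡ᵇy
  ... | true  = cong var (sym (≡ᵇ-true⇒≡ z≡ᵇy))
  ... | false = σz

  ≗var-update : ∀ {σ} y → σ ≗ var → (σ [ y ↦ var y ]) ≗ var
  ≗var-update {σ} y σ≗var z = update-var-fixes σ y z (σ≗var z)

  mutual
    substT-id : ∀ {σ} → σ ≗ var → ∀ t → substT σ t ≡ t
    substT-id σ≗var (var x)    = σ≗var x
    substT-id σ≗var (fun f ts) = cong (fun f) (substTs-id σ≗var ts)

    substTs-id : ∀ {σ} → σ ≗ var → ∀ {n} (ts : Vec Term n) → substTs σ ts ≡ ts
    substTs-id σ≗var []       = refl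
    substTs-id σ≗var (t ∷ ts) = cong₂ _∷_ (substT-id σ≗var t) (substTs-id σ≗var ts)

  sub2-id : ∀ {σ} → σ ≗ var → ∀ C → sub2 σ C ≡ C
  sub2-id σ≗var ⊥₂          = refl
  sub2-id σ≗var (SV n i ts) = cong (SV n i) (substTs-id σ≗var ts)
  sub2-id σ≗var (A ⇒₂ B)    = cong₂ _⇒₂_ (sub2-id σ≗var A) (sub2-id σ≗var B)
  sub2-id σ≗var (A ∧₂ B)    = cong₂ _∧₂_ (sub2-id σ≗var A) (sub2-id σ≗var B)
  sub2-id σ≗var (A ∨₂ B)    = cong₂ _∨₂_ (sub2-id σ≗var A) (sub2-id σ≗var B)
  sub2-id σ≗var (∀ᵢ y A)    = cong (∀ᵢ y) (sub2-id (≗var-update y σ≗var) A)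
  sub2-id σ≗var (∃ᵢ y A)    = cong (∃ᵢ y) (sub2-id (≗var-update y σ≗var) A)
  sub2-id σ≗var (∀ₛ m j A)  = cong (∀ₛ m j) (sub2-id σ≗var A)
  sub2-id σ≗var (∃ₛ m j A)  = cong (∃ₛ m j) (sub2-id σ≗var A)

  var-no-capture : ∀ {σ} → σ ≗ var → ∀ y z → T (not (z ≡ᵇ y)) → T (not (occT y (σ z)))
  var-no-capture σ≗var y z z≢y rewrite σ≗var z | ≡ᵇ-sym y z = z≢y

  freeFor2-id : ∀ {σ} → σ ≗ var → ∀ C → FreeFor2 σ C
  freeFor2-id σ≗var ⊥₂          = tt
  freeFor2-id σ≗var (SV n i ts) = tt
  freeFor2-id σ≗var (A ⇒₂ B)    = freeFor2-id σ≗var A , freeFor2-id σ≗var B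
  freeFor2-id σ≗var (A ∧₂ B)    = freeFor2-id σ≗var A , freeFor2-id σ≗var B
  freeFor2-id σ≗var (A ∨₂ B)    = freeFor2-id σ≗var A , freeFor2-id σ≗var B
  freeFor2-id σ≗var (∀ᵢ y A)    =
    freeFor2-id (≗var-update y σ≗var) A , λ z → var-no-capture σ≗var y z ∘ ∧-proj₁
  freeFor2-id σ≗var (∃ᵢ y A)    =
    freeFor2-id (≗var-update y σ≗var) A , λ z → var-no-capture σ≗var y z ∘ ∧-proj₁
  freeFor2-id σ≗var (∀ₛ m j A)  = freeFor2-id σ≗var A
  freeFor2-id σ≗var (∃ₛ m j A)  = freeFor2-id σ≗var A

  freeSV-sub2 : ∀ n j σ C → freeSV n j (sub2 σ C) ≡ freeSV n j C
  freeSV-sub2 n j σ ⊥₂          = refl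
  freeSV-sub2 n j σ (SV m i ts) = refl
  freeSV-sub2 n j σ (A ⇒₂ B)    = cong₂ _∨_ (freeSV-sub2 n j σ A) (freeSV-sub2 n j σ B)
  freeSV-sub2 n j σ (A ∧₂ B)    = cong₂ _∨_ (freeSV-sub2 n j σ A) (freeSV-sub2 n j σ B)
  freeSV-sub2 n j σ (A ∨₂ B)    = cong₂ _∨_ (freeSV-sub2 n j σ A) (freeSV-sub2 n j σ B)
  freeSV-sub2 n j σ (∀ᵢ y A)    = freeSV-sub2 n j _ A
  freeSV-sub2 n j σ (∃ᵢ y A)    = freeSV-sub2 n j _ A
  freeSV-sub2 n j σ (∀ₛ m i A)  = cong (not (sameSV n j m i) ∧_) (freeSV-sub2 n j σ A)
  freeSV-sub2 n j σ (∃ₛ m i A)  = cong (not (sameSV n j m i) ∧_) (freeSV-sub2 n j σ A)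

  inst-notFree : ∀ n i (L : Abs n) C → freeSV n i C ≡ false → inst n i L C ≡ C
  inst-notFree n i L ⊥₂ _ = refl
  inst-notFree n i L (SV m j ts) notFree with n ℕ.≟ m
  ... | no _ = refl
  ... | yes refl with i ≡ᵇ j
  ...   | false = refl
  ...   | true rewrite ≡ᵇ-refl n with notFree
  ...     | ()
  inst-notFree n i L (A ⇒₂ B) notFree = let a , b = ∨-false⁻ notFree in
    cong₂ _⇒₂_ (inst-notFree n i L A a) (inst-notFree n i L B b)
  inst-notFree n i L (A ∧₂ B) notFree = let a , b = ∨-false⁻ notFree in
    cong₂ _∧₂_ (inst-notFree n i L A a) (inst-notFree n i L B b)
  inst-notFree n i L (A ∨₂ B) notFree = let a , b = ∨-false⁻ notFree in
    cong₂ _∨₂_ (inst-notFree n i L A a) (inst-notFree n i L B b)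
  inst-notFree n i L (∀ᵢ y A) notFree = cong (∀ᵢ y) (inst-notFree n i L A notFree)
  inst-notFree n i L (∃ᵢ y A) notFree = cong (∃ᵢ y) (inst-notFree n i L A notFree)
  inst-notFree n i L (∀ₛ m j A) notFree with sameSV n i m j
  ... | true  = refl
  ... | false = cong (∀ₛ m j) (inst-notFree n i L A notFree)
  inst-notFree n i L (∃ₛ m j A) notFree with sameSV n i m j
  ... | true  = refl
  ... | false = cong (∃ₛ m j) (inst-notFree n i L A notFree)

  freeForAbs-notFree : ∀ n i (L : Abs n) C → freeSV n i C ≡ false → FreeForAbs n i L C
  freeForAbs-notFree n i L ⊥₂ _ = tt
  freeForAbs-notFree n i L (SV m j ts) notFree with n ℕ.≟ m
  ... | no _ = tt
  ... | yes refl with i ≡ᵇ j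
  ...   | false = tt
  ...   | true rewrite ≡ᵇ-refl n with notFree
  ...     | ()
  freeForAbs-notFree n i L (A ⇒₂ B) notFree = let a , b = ∨-false⁻ notFree in
    freeForAbs-notFree n i L A a , freeForAbs-notFree n i L B b
  freeForAbs-notFree n i L (A ∧₂ B) notFree = let a , b = ∨-false⁻ notFree in
    freeForAbs-notFree n i L A a , freeForAbs-notFree n i L B b
  freeForAbs-notFree n i L (A ∨₂ B) notFree = let a , b = ∨-false⁻ notFree in
    freeForAbs-notFree n i L A a , freeForAbs-notFree n i L B b
  freeForAbs-notFree n i L (∀ᵢ y A) notFree =
    freeForAbs-notFree n i L A notFree , ⊥-elim ∘ subst T notFree
  freeForAbs-notFree n i L (∃ᵢ y A) notFree =
    freeForAbs-notFree n i L A notFree , ⊥-elim ∘ subst T notFree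
  freeForAbs-notFree n i L (∀ₛ m j A) notFree with sameSV n i m j
  ... | true  = tt
  ... | false = freeForAbs-notFree n i L A notFree , ⊥-elim ∘ subst T notFree
  freeForAbs-notFree n i L (∃ₛ m j A) notFree with sameSV n i m j
  ... | true  = tt
  ... | false = freeForAbs-notFree n i L A notFree , ⊥-elim ∘ subst T notFree

  freeSV-inst : ∀ n i (L : Abs n) m j C → sameSV m j n i ≡ false →
                freeSV m j (Abs.body L) ≡ false → freeSV m j (inst n i L C) ≡ freeSV m j C
  freeSV-inst n i L m j ⊥₂ _ _ = refl
  freeSV-inst n i L m j (SV m′ j′ ts) distinct notInBody with n ℕ.≟ m′
  ... | no _ = refl
  ... | yes refl with i ≡ᵇ j′ in i≡ᵇj′
  ...   | false = refl
  ...   | true with refl ← ≡ᵇ-true⇒≡ {i} {j′} i≡ᵇj′ =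
          trans (freeSV-sub2 m j _ (Abs.body L)) (trans notInBody (sym distinct))
  freeSV-inst n i L m j (A ⇒₂ B) d nb =
    cong₂ _∨_ (freeSV-inst n i L m j A d nb) (freeSV-inst n i L m j B d nb)
  freeSV-inst n i L m j (A ∧₂ B) d nb =
    cong₂ _∨_ (freeSV-inst n i L m j A d nb) (freeSV-inst n i L m j B d nb)
  freeSV-inst n i L m j (A ∨₂ B) d nb =
    cong₂ _∨_ (freeSV-inst n i L m j A d nb) (freeSV-inst n i L m j B d nb)
  freeSV-inst n i L m j (∀ᵢ y A) d nb = freeSV-inst n i L m j A d nb
  freeSV-inst n i L m j (∃ᵢ y A) d nb = freeSV-inst n i L m j A d nb
  freeSV-inst n i L m j (∀ₛ m′ j′ A) d nb with sameSV n i m′ j′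
  ... | true  = refl
  ... | false = cong (not (sameSV m j m′ j′) ∧_) (freeSV-inst n i L m j A d nb)
  freeSV-inst n i L m j (∃ₛ m′ j′ A) d nb with sameSV n i m′ j′
  ... | true  = refl
  ... | false = cong (not (sameSV m j m′ j′) ∧_) (freeSV-inst n i L m j A d nb)

  paramVars : (n : ℕ) → Vec ℕ n
  paramVars zero    = []
  paramVars (suc n) = n ∷ paramVars n

  occ-paramVars⇒< : ∀ n y → occTs y (map var (paramVars n)) ≡ true → y < n
  occ-paramVars⇒< (suc n) y occ with y ≡ᵇ n in y≡ᵇn
  ... | true  with refl ← ≡ᵇ-true⇒≡ {y} {n} y≡ᵇn = ≤-refl
  ... | false = m≤n⇒m≤1+n (occ-paramVars⇒< n y occ)

  mutual
    substT-cong : ∀ {σ τ} t → (∀ y → occT y t ≡ true → σ y ≡ τ y) →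
                  substT σ t ≡ substT τ t
    substT-cong (var x)    σ≗τ = σ≗τ x (≡ᵇ-refl x)
    substT-cong (fun f ts) σ≗τ = cong (fun f) (substTs-cong ts σ≗τ)

    substTs-cong : ∀ {σ τ k} (ts : Vec Term k) → (∀ y → occTs y ts ≡ true → σ y ≡ τ y) →
                   substTs σ ts ≡ substTs τ ts
    substTs-cong []       σ≗τ = refl
    substTs-cong (t ∷ ts) σ≗τ = cong₂ _∷_
      (substT-cong t (λ y occ → σ≗τ y (cong (_∨ _) occ)))
      (substTs-cong ts (λ y occ → σ≗τ y (trans (cong (occT y t ∨_) occ) (∨-zeroʳ _))))

  argSubst-paramVars : ∀ n (ts : Vec Term n) →
                       substTs (argSubst (paramVars n) ts) (map var (paramVars n)) ≡ ts
  argSubst-paramVars zero    []       = refl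
  argSubst-paramVars (suc n) (t ∷ ts) = cong₂ _∷_ head (trans tail (argSubst-paramVars n ts))
    where
    head : argSubst (n ∷ paramVars n) (t ∷ ts) n ≡ t
    head with occTs n (map var (paramVars n)) in occ
    ... | false rewrite ≡ᵇ-refl n = refl
    ... | true  = ⊥-elim (<-irrefl refl (occ-paramVars⇒< n n occ))
    tail : substTs (argSubst (n ∷ paramVars n) (t ∷ ts)) (map var (paramVars n))
         ≡ substTs (argSubst (paramVars n) ts) (map var (paramVars n))
    tail = substTs-cong (map var (paramVars n)) λ y occ →
      cong (λ b → if b ∧ not (occTs y (map var (paramVars n))) then t else argSubst (paramVars n) ts y)
           (≢⇒≡ᵇ-false (<⇒≢ (occ-paramVars⇒< n y occ)))

  freeForAbs-SV : ∀ n i (L : Abs n) m j ts → (∀ σ → FreeFor2 σ (Abs.body L)) →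
                  FreeForAbs n i L (SV m j ts)
  freeForAbs-SV n i L m j ts body-ok with n ℕ.≟ m
  ... | no _ = tt
  ... | yes refl with i ≡ᵇ j
  ...   | true  = body-ok _
  ...   | false = tt

  idAbs : ∀ n → ℕ → Abs n
  idAbs n i = ƛ (paramVars n) (SV n i (map var (paramVars n)))

  inst-idAbs : ∀ n i C → inst n i (idAbs n i) C ≡ C
  inst-idAbs n i ⊥₂ = refl
  inst-idAbs n i (SV m j ts) with n ℕ.≟ m
  ... | no _ = refl
  ... | yes refl with i ≡ᵇ j in i≡ᵇj
  ...   | false = refl
  ...   | true with refl ← ≡ᵇ-true⇒≡ {i} {j} i≡ᵇj = cong (SV n i) (argSubst-paramVars n ts)
  inst-idAbs n i (A ⇒₂ B) = cong₂ _⇒₂_ (inst-idAbs n i A) (inst-idAbs n i B)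
  inst-idAbs n i (A ∧₂ B) = cong₂ _∧₂_ (inst-idAbs n i A) (inst-idAbs n i B)
  inst-idAbs n i (A ∨₂ B) = cong₂ _∨₂_ (inst-idAbs n i A) (inst-idAbs n i B)
  inst-idAbs n i (∀ᵢ y A) = cong (∀ᵢ y) (inst-idAbs n i A)
  inst-idAbs n i (∃ᵢ y A) = cong (∃ᵢ y) (inst-idAbs n i A)
  inst-idAbs n i (∀ₛ m j A) with sameSV n i m j
  ... | true  = refl
  ... | false = cong (∀ₛ m j) (inst-idAbs n i A)
  inst-idAbs n i (∃ₛ m j A) with sameSV n i m j
  ... | true  = refl
  ... | false = cong (∃ₛ m j) (inst-idAbs n i A)

  freeAbs-idAbs : ∀ n i y → freeAbs y (idAbs n i) ≡ false
  freeAbs-idAbs n i y with occTs y (map var (paramVars n))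
  ... | true  = refl
  ... | false = refl

  freeForAbs-idAbs : ∀ n i C → FreeForAbs n i (idAbs n i) C
  freeForAbs-idAbs n i ⊥₂ = tt
  freeForAbs-idAbs n i (SV m j ts) = freeForAbs-SV n i (idAbs n i) m j ts λ _ → tt
  freeForAbs-idAbs n i (A ⇒₂ B) = freeForAbs-idAbs n i A , freeForAbs-idAbs n i B
  freeForAbs-idAbs n i (A ∧₂ B) = freeForAbs-idAbs n i A , freeForAbs-idAbs n i B
  freeForAbs-idAbs n i (A ∨₂ B) = freeForAbs-idAbs n i A , freeForAbs-idAbs n i B
  freeForAbs-idAbs n i (∀ᵢ y A) = freeForAbs-idAbs n i A , λ _ → from T-not-≡ (freeAbs-idAbs n i y)
  freeForAbs-idAbs n i (∃ᵢ y A) = freeForAbs-idAbs n i A , λ _ → from T-not-≡ (freeAbs-idAbs n i y)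
  freeForAbs-idAbs n i (∀ₛ m j A) with sameSV n i m j in same
  ... | true  = tt
  ... | false = freeForAbs-idAbs n i A , λ _ → from T-not-≡ (trans (sameSV-sym m j n i) same)
  freeForAbs-idAbs n i (∃ₛ m j A) with sameSV n i m j in same
  ... | true  = tt
  ... | false = freeForAbs-idAbs n i A , λ _ → from T-not-≡ (trans (sameSV-sym m j n i) same)

  inst-SV-other : ∀ n i (L : Abs n) m j ts → n ≢ m → inst n i L (SV m j ts) ≡ SV m j ts
  inst-SV-other n i L m j ts n≢m with n ℕ.≟ m
  ... | yes n≡m = ⊥-elim (n≢m n≡m)
  ... | no _    = refl

  inst-SV-same : ∀ n i (L : Abs n) j ts →
                 inst n i L (SV n j ts)
                 ≡ (if i ≡ᵇ j then sub2 (argSubst (Abs.params L) ts) (Abs.body L) else SV n j ts)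
  inst-SV-same n i L j ts with n ℕ.≟ n
  ... | yes refl = refl
  ... | no n≢n   = ⊥-elim (n≢n refl)

  data SOQuantifier : (ℕ → ℕ → Form2 → Form2) → Set where
    ∀q : SOQuantifier ∀ₛ
    ∃q : SOQuantifier ∃ₛ

  block : (ℕ → ℕ → Form2 → Form2) → (ℕ → ℕ) → List ℕ → Form2 → Form2
  block Q v l C = foldr (λ n B → Q n (v n) B) C l

  module _ {Q : ℕ → ℕ → Form2 → Form2} (v : ℕ → ℕ) where

    free2-block : SOQuantifier Q → ∀ l C z → free2 z (block Q v l C) ≡ free2 z C
    free2-block q  []      C z = refl
    free2-block ∀q (m ∷ l) C z = free2-block ∀q l C z
    free2-block ∃q (m ∷ l) C z = free2-block ∃q l C z

    freeSV-block⇒freeSV : SOQuantifier Q → ∀ l C n j →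
                          T (freeSV n j (block Q v l C)) → T (freeSV n j C)
    freeSV-block⇒freeSV q  []      C n j free = free
    freeSV-block⇒freeSV ∀q (m ∷ l) C n j free = freeSV-block⇒freeSV ∀q l C n j (∧-proj₂ free)
    freeSV-block⇒freeSV ∃q (m ∷ l) C n j free = freeSV-block⇒freeSV ∃q l C n j (∧-proj₂ free)

    freeSV-block-bound : SOQuantifier Q → ∀ l C n → n ∈ l → freeSV n (v n) (block Q v l C) ≡ false
    freeSV-block-bound ∀q (m ∷ l) C n (here refl) rewrite sameSV-refl n (v n) = refl
    freeSV-block-bound ∃q (m ∷ l) C n (here refl) rewrite sameSV-refl n (v n) = refl
    freeSV-block-bound ∀q (m ∷ l) C n (there n∈l)
      rewrite freeSV-block-bound ∀q l C n n∈l = ∧-zeroʳ _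
    freeSV-block-bound ∃q (m ∷ l) C n (there n∈l)
      rewrite freeSV-block-bound ∃q l C n n∈l = ∧-zeroʳ _

    freeSV-block-distinct : SOQuantifier Q → ∀ l C n j → All (λ m → sameSV n j m (v m) ≡ false) l →
                            freeSV n j (block Q v l C) ≡ freeSV n j C
    freeSV-block-distinct q  []      C n j []       = refl
    freeSV-block-distinct ∀q (m ∷ l) C n j (d ∷ ds) rewrite d = freeSV-block-distinct ∀q l C n j ds
    freeSV-block-distinct ∃q (m ∷ l) C n j (d ∷ ds) rewrite d = freeSV-block-distinct ∃q l C n j ds

    sub2-block : SOQuantifier Q → ∀ σ l C → sub2 σ (block Q v l C) ≡ block Q v l (sub2 σ C)
    sub2-block q  σ []      C = refl
    sub2-block ∀q σ (m ∷ l) C = cong (∀ₛ m (v m)) (sub2-block ∀q σ l C)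
    sub2-block ∃q σ (m ∷ l) C = cong (∃ₛ m (v m)) (sub2-block ∃q σ l C)

    freeFor2-block : SOQuantifier Q → ∀ σ l C → FreeFor2 σ C → FreeFor2 σ (block Q v l C)
    freeFor2-block q  σ []      C ff = ff
    freeFor2-block ∀q σ (m ∷ l) C ff = freeFor2-block ∀q σ l C ff
    freeFor2-block ∃q σ (m ∷ l) C ff = freeFor2-block ∃q σ l C ff

    inst-block : SOQuantifier Q → ∀ n i (L : Abs n) l C →
                 All (λ m → sameSV n i m (v m) ≡ false) l →
                 inst n i L (block Q v l C) ≡ block Q v l (inst n i L C)
    inst-block q  n i L []      C []       = refl
    inst-block ∀q n i L (m ∷ l) C (d ∷ ds) rewrite d =
      cong (∀ₛ m (v m)) (inst-block ∀q n i L l C ds)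
    inst-block ∃q n i L (m ∷ l) C (d ∷ ds) rewrite d =
      cong (∃ₛ m (v m)) (inst-block ∃q n i L l C ds)

    freeForAbs-block : SOQuantifier Q → ∀ n i (L : Abs n) l C →
                       All (λ m → sameSV n i m (v m) ≡ false) l →
                       All (λ m → T (freeSV n i C) → freeSV m (v m) (Abs.body L) ≡ false) l →
                       FreeForAbs n i L C → FreeForAbs n i L (block Q v l C)
    freeForAbs-block q  n i L []      C []       []       ff = ff
    freeForAbs-block ∀q n i L (m ∷ l) C (d ∷ ds) (u ∷ us) ff rewrite d =
      freeForAbs-block ∀q n i L l C ds us ff , from T-not-≡ ∘ u ∘ freeSV-block⇒freeSV ∀q l C n i
    freeForAbs-block ∃q n i L (m ∷ l) C (d ∷ ds) (u ∷ us) ff rewrite d =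
      freeForAbs-block ∃q n i L l C ds us ff , from T-not-≡ ∘ u ∘ freeSV-block⇒freeSV ∃q l C n i

  ∀-block-intro : ∀ {k Θ} v l {C} → (∀ n → NotFreeSVIn2 n (v n) Θ) →
                  Der2 k Θ C → Der2 k Θ (block ∀ₛ v l C)
  ∀-block-intro v []      nf d = d
  ∀-block-intro v (n ∷ l) nf d = ∀²I n (v n) (nf n) (∀-block-intro v l nf d)

  ∀-block-elim-id : ∀ {k Θ} v l D → Der2 k Θ (block ∀ₛ v l D) → Der2 k Θ D
  ∀-block-elim-id v []      D d = d
  ∀-block-elim-id {k} {Θ} v (n ∷ l) D d =
    ∀-block-elim-id v l D (subst (Der2 k Θ) (inst-idAbs n (v n) (block ∀ₛ v l D))
      (∀²E (idAbs n (v n)) (freeForAbs-idAbs n (v n) (block ∀ₛ v l D)) d))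

  MovesOnly : ℕ → Subst → Set
  MovesOnly x σ = ∀ z → z ≢ x → σ z ≡ var z

  MovesOnly-update : ∀ {x σ} y → MovesOnly x σ → MovesOnly x (σ [ y ↦ var y ])
  MovesOnly-update {σ = σ} y moves z z≢x = update-var-fixes σ y z (moves z z≢x)

  MovesOnly-update-self : ∀ {x σ} → MovesOnly x σ → (σ [ x ↦ var x ]) ≗ var
  MovesOnly-update-self {x} {σ} moves z with z ℕ.≟ x
  ... | yes refl rewrite ≡ᵇ-refl z = refl
  ... | no z≢x   = update-var-fixes σ x z (moves z z≢x)

  update-var-other : ∀ σ {x y} → x ≢ y → (σ [ y ↦ var y ]) x ≡ σ x
  update-var-other σ x≢y rewrite ≢⇒≡ᵇ-false x≢y = refl

  MovesOnly-[↦] : ∀ x t → MovesOnly x (ι [ x ↦ t ])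
  MovesOnly-[↦] x t z z≢x rewrite ≢⇒≡ᵇ-false z≢x = refl

  record SendsOnly (x : ℕ) (t : Term) (σ : Subst) : Set where
    field
      sends : σ x ≡ t
      only  : MovesOnly x σ

  SendsOnly-update : ∀ {x t σ y} → y ≢ x → SendsOnly x t σ → SendsOnly x t (σ [ y ↦ var y ])
  SendsOnly-update {σ = σ} y≢x s = record
    { sends = trans (update-var-other σ (y≢x ∘ sym)) (SendsOnly.sends s)
    ; only  = MovesOnly-update _ (SendsOnly.only s) }

  SendsOnly-[↦] : ∀ x t → SendsOnly x t (ι [ x ↦ t ])
  SendsOnly-[↦] x t = record
    { sends = cong (λ b → if b then t else var x) (≡ᵇ-refl x)
    ; only  = MovesOnly-[↦] x t }

  -- σ acts on every argument, but on the head of Ap n only at the marked arities n: the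
  -- marking interpolates between sub2 σ on codes (nothing marked) and sub1 σ (all marked).
  psub : (ℕ → Bool) → Subst → Form1 → Form1
  psub marked σ ⊥₁          = ⊥₁
  psub marked σ (Ap n h ts) = Ap n (if marked n then substT σ h else h) (substTs σ ts)
  psub marked σ (A ⇒₁ B)    = psub marked σ A ⇒₁ psub marked σ B
  psub marked σ (A ∧₁ B)    = psub marked σ A ∧₁ psub marked σ B
  psub marked σ (A ∨₁ B)    = psub marked σ A ∨₁ psub marked σ B
  psub marked σ (∀₁ y A)    = ∀₁ y (psub marked (σ [ y ↦ var y ]) A)
  psub marked σ (∃₁ y A)    = ∃₁ y (psub marked (σ [ y ↦ var y ]) A)

  psub-all : ∀ σ A → psub (λ _ → true) σ A ≡ sub1 σ A
  psub-all σ ⊥₁          = refl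
  psub-all σ (Ap n h ts) = refl
  psub-all σ (A ⇒₁ B)    = cong₂ _⇒₁_ (psub-all σ A) (psub-all σ B)
  psub-all σ (A ∧₁ B)    = cong₂ _∧₁_ (psub-all σ A) (psub-all σ B)
  psub-all σ (A ∨₁ B)    = cong₂ _∨₁_ (psub-all σ A) (psub-all σ B)
  psub-all σ (∀₁ y A)    = cong (∀₁ y) (psub-all _ A)
  psub-all σ (∃₁ y A)    = cong (∃₁ y) (psub-all _ A)

  mutual
    occT-substT⇒occT : ∀ {x σ} → MovesOnly x σ → ∀ t → T (occT x (substT σ t)) → T (occT x t)
    occT-substT⇒occT {x} moves (var z) occ with z ℕ.≟ x
    ... | yes refl rewrite ≡ᵇ-refl z = tt
    ... | no z≢x   rewrite moves z z≢x = occ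
    occT-substT⇒occT moves (fun f ts) occ = occTs-substTs⇒occTs moves ts occ

    occTs-substTs⇒occTs : ∀ {x σ} → MovesOnly x σ → ∀ {k} (ts : Vec Term k) →
                          T (occTs x (substTs σ ts)) → T (occTs x ts)
    occTs-substTs⇒occTs moves (t ∷ ts) =
      ∨-mono (occT-substT⇒occT moves t) (occTs-substTs⇒occTs moves ts)

  free1-psub⇒free1 : ∀ {x σ} marked → MovesOnly x σ → ∀ B →
                     T (free1 x (psub marked σ B)) → T (free1 x B)
  free1-psub⇒free1 marked moves (Ap n h ts) with marked n
  ... | true  = ∨-mono (occT-substT⇒occT moves h) (occTs-substTs⇒occTs moves ts)
  ... | false = ∨-mono (λ occ → occ) (occTs-substTs⇒occTs moves ts)
  free1-psub⇒free1 marked moves (A ⇒₁ B) =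
    ∨-mono (free1-psub⇒free1 marked moves A) (free1-psub⇒free1 marked moves B)
  free1-psub⇒free1 marked moves (A ∧₁ B) =
    ∨-mono (free1-psub⇒free1 marked moves A) (free1-psub⇒free1 marked moves B)
  free1-psub⇒free1 marked moves (A ∨₁ B) =
    ∨-mono (free1-psub⇒free1 marked moves A) (free1-psub⇒free1 marked moves B)
  free1-psub⇒free1 marked moves (∀₁ y A) =
    ∧-monoʳ (free1-psub⇒free1 marked (MovesOnly-update y moves) A)
  free1-psub⇒free1 marked moves (∃₁ y A) =
    ∧-monoʳ (free1-psub⇒free1 marked (MovesOnly-update y moves) A)

  mark : ℕ → (ℕ → Bool) → ℕ → Bool
  mark n marked m = (m ≡ᵇ n) ∨ marked m

  markAll : List ℕ → (ℕ → Bool) → ℕ → Bool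
  markAll []      marked = marked
  markAll (n ∷ l) marked = markAll l (mark n marked)

  markAll-keeps : ∀ l marked m → marked m ≡ true → markAll l marked m ≡ true
  markAll-keeps []      marked m marked-m = marked-m
  markAll-keeps (n ∷ l) marked m marked-m =
    markAll-keeps l (mark n marked) m (trans (cong ((m ≡ᵇ n) ∨_) marked-m) (∨-zeroʳ _))

  markAll-marks : ∀ l marked m → m ∈ l → markAll l marked m ≡ true
  markAll-marks (n ∷ l) marked m (here refl) =
    markAll-keeps l (mark n marked) m (cong (_∨ marked m) (≡ᵇ-refl m))
  markAll-marks (n ∷ l) marked m (there m∈l) = markAll-marks l (mark n marked) m m∈l

  mark-unmarked : ∀ n marked {l} → All (n ≢_) l → All (λ m → marked m ≡ false) l →
                  All (λ m → mark n marked m ≡ false) l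
  mark-unmarked n marked []           []                     = []
  mark-unmarked n marked {m ∷ _} (n≢m ∷ n∉l) (unmarked ∷ unmarked′) =
    trans (cong (_∨ marked m) (≢⇒≡ᵇ-false (n≢m ∘ sym))) unmarked ∷
    mark-unmarked n marked n∉l unmarked′

module CodingProperties (S : Signature) (φ : (n : ℕ) → ℕ ↔ ℕ) where
  open Syntax S
  open Coding φ
  open SyntaxProperties S

  soVar : ℕ → ℕ → ℕ
  soVar x n = φ⁻¹ n x

  φ⁻¹-injective : ∀ n {a b} → φ⁻¹ n a ≡ φ⁻¹ n b → a ≡ b
  φ⁻¹-injective n {a} {b} e = begin
    a                               ≡⟨ sym (Inverse.strictlyInverseˡ (φ n) a) ⟩
    Inverse.to (φ n) (φ⁻¹ n a)      ≡⟨ cong (Inverse.to (φ n)) e ⟩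
    Inverse.to (φ n) (φ⁻¹ n b)      ≡⟨ Inverse.strictlyInverseˡ (φ n) b ⟩
    b                               ∎
    where open ≡-Reasoning

  sameSV-soVar : ∀ {z y} n m → z ≢ y → sameSV n (soVar z n) m (soVar y m) ≡ false
  sameSV-soVar {z} {y} n m z≢y =
    sameSV-false⁺ n (soVar z n) m (soVar y m) λ { refl → z≢y ∘ φ⁻¹-injective n }

  freeSV⇒<arBound : ∀ n j C → T (freeSV n j C) → n < arBound C

  freeSV⇒<arBound-∨ : ∀ n j A B → T (freeSV n j A ∨ freeSV n j B) → n < arBound A ⊔ arBound B
  freeSV⇒<arBound-∨ n j A B free with to (T-∨ {freeSV n j A}) free
  ... | inj₁ inA = ≤-trans (freeSV⇒<arBound n j A inA) (m≤m⊔n (arBound A) (arBound B))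
  ... | inj₂ inB = ≤-trans (freeSV⇒<arBound n j B inB) (m≤n⊔m (arBound A) (arBound B))

  freeSV⇒<arBound n j (SV m i ts) free with refl , _ ← sameSV-true⁻ n j m i (to T-≡ free) = ≤-refl
  freeSV⇒<arBound n j (A ⇒₂ B) free = freeSV⇒<arBound-∨ n j A B free
  freeSV⇒<arBound n j (A ∧₂ B) free = freeSV⇒<arBound-∨ n j A B free
  freeSV⇒<arBound n j (A ∨₂ B) free = freeSV⇒<arBound-∨ n j A B free
  freeSV⇒<arBound n j (∀ᵢ y A) free = freeSV⇒<arBound n j A free
  freeSV⇒<arBound n j (∃ᵢ y A) free = freeSV⇒<arBound n j A free
  freeSV⇒<arBound n j (∀ₛ m i A) free =
    ≤-trans (freeSV⇒<arBound n j A (∧-proj₂ free)) (m≤n⊔m (suc m) _)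
  freeSV⇒<arBound n j (∃ₛ m i A) free =
    ≤-trans (freeSV⇒<arBound n j A (∧-proj₂ free)) (m≤n⊔m (suc m) _)

  ∈-arities⁺ : ∀ x C n → T (freeSV n (soVar x n) C) → n ∈ arities x C
  ∈-arities⁺ x C n free =
    ∈-filter⁺ (λ m → T? (freeSV m (soVar x m) C)) (∈-upTo⁺ (freeSV⇒<arBound n _ C free)) free

  arities-unique : ∀ x C → Unique (arities x C)
  arities-unique x C = Unique.filter⁺ (λ n → T? (freeSV n (soVar x n) C)) (Unique.upTo⁺ (arBound C))

  arities-cong : ∀ y C C′ → (∀ m → freeSV m (soVar y m) C ≡ freeSV m (soVar y m) C′) →
                 arities y C ≡ arities y C′
  arities-cong y C C′ same = begin
    filterᵇ p  (upTo b)        ≡⟨ filterᵇ-upTo-extend p  p-bound  (m≤m⊔n b b′) ⟩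
    filterᵇ p  (upTo (b ⊔ b′)) ≡⟨ filter-≐ (T? ∘ p) (T? ∘ p′) (p⇒p′ , p′⇒p) (upTo (b ⊔ b′)) ⟩
    filterᵇ p′ (upTo (b ⊔ b′)) ≡⟨ filterᵇ-upTo-extend p′ p′-bound (m≤n⊔m b b′) ⟨
    filterᵇ p′ (upTo b′)       ∎
    where
    open ≡-Reasoning
    b b′ : ℕ
    b  = arBound C
    b′ = arBound C′
    p p′ : ℕ → Bool
    p  m = freeSV m (soVar y m) C
    p′ m = freeSV m (soVar y m) C′
    p⇒p′ : ∀ {m} → T (p m) → T (p′ m)
    p⇒p′ {m} = subst T (same m)
    p′⇒p : ∀ {m} → T (p′ m) → T (p m)
    p′⇒p {m} = subst T (sym (same m))
    p-bound : ∀ m → T (p m) → m < arBound C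
    p-bound m = freeSV⇒<arBound m _ C
    p′-bound : ∀ m → T (p′ m) → m < arBound C′
    p′-bound m = freeSV⇒<arBound m _ C′

  quantSV-binds : ∀ {Q} → SOQuantifier Q → ∀ x C n → freeSV n (soVar x n) (quantSV Q x C) ≡ false
  quantSV-binds q x C n with freeSV n (soVar x n) C in free
  ... | true  = freeSV-block-bound (soVar x) q (arities x C) C n (∈-arities⁺ x C n (from T-≡ free))
  ... | false = to T-not-≡
    (contraposeᵇ (freeSV-block⇒freeSV (soVar x) q (arities x C) C n _) (from T-not-≡ free))

  quantSV-distinct : ∀ {Q} → SOQuantifier Q → ∀ {z y} C n → z ≢ y →
                     freeSV n (soVar z n) (quantSV Q y C) ≡ freeSV n (soVar z n) C
  quantSV-distinct q {z} {y} C n z≢y =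
    freeSV-block-distinct (soVar y) q (arities y C) C n _ (tabulate λ {m} _ → sameSV-soVar n m z≢y)

  sub2-quantSV : ∀ {Q} → SOQuantifier Q → ∀ y σ {C C′} → sub2 σ C ≡ C′ →
                 sub2 σ (quantSV Q y C) ≡ quantSV Q y C′
  sub2-quantSV {Q} q y σ {C} {C′} refl =
    trans (sub2-block (soVar y) q σ (arities y C) C)
          (cong (λ l → block Q (soVar y) l C′)
                (arities-cong y C C′ λ m → sym (freeSV-sub2 m (soVar y m) σ C)))

  sub2-code : ∀ σ A → sub2 σ (code A) ≡ code (psub (λ _ → false) σ A)
  sub2-code σ ⊥₁                   = refl
  sub2-code σ (Ap n (var z) ts)    = refl
  sub2-code σ (Ap n (fun f us) ts) = refl
  sub2-code σ (A ⇒₁ B)             = cong₂ _⇒₂_ (sub2-code σ A) (sub2-code σ B)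
  sub2-code σ (A ∧₁ B)             = cong₂ _∧₂_ (sub2-code σ A) (sub2-code σ B)
  sub2-code σ (A ∨₁ B)             = cong₂ _∨₂_ (sub2-code σ A) (sub2-code σ B)
  sub2-code σ (∀₁ y A)             = cong (∀ᵢ y) (sub2-quantSV ∀q y _ (sub2-code _ A))
  sub2-code σ (∃₁ y A)             = cong (∃ᵢ y) (sub2-quantSV ∃q y _ (sub2-code _ A))

  freeSV-code⇒free1 : ∀ A n z → T (freeSV n (soVar z n) (code A)) → T (free1 z A)
  freeSV-code⇒free1 (Ap m (var w) ts) n z free
    with refl , same ← sameSV-true⁻ n (soVar z n) m (soVar w m) (to T-≡ free)
    rewrite φ⁻¹-injective n same | ≡ᵇ-refl w = tt
  freeSV-code⇒free1 (A ⇒₁ B) n z = ∨-mono (freeSV-code⇒free1 A n z) (freeSV-code⇒free1 B n z)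
  freeSV-code⇒free1 (A ∧₁ B) n z = ∨-mono (freeSV-code⇒free1 A n z) (freeSV-code⇒free1 B n z)
  freeSV-code⇒free1 (A ∨₁ B) n z = ∨-mono (freeSV-code⇒free1 A n z) (freeSV-code⇒free1 B n z)
  freeSV-code⇒free1 (∀₁ y A) n z free with z ℕ.≟ y
  ... | yes refl = ⊥-elim (subst T (quantSV-binds ∀q z (code A) n) free)
  ... | no z≢y rewrite ≢⇒≡ᵇ-false z≢y =
        freeSV-code⇒free1 A n z (subst T (quantSV-distinct ∀q (code A) n z≢y) free)
  freeSV-code⇒free1 (∃₁ y A) n z free with z ℕ.≟ y
  ... | yes refl = ⊥-elim (subst T (quantSV-binds ∃q z (code A) n) free)
  ... | no z≢y rewrite ≢⇒≡ᵇ-false z≢y =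
        freeSV-code⇒free1 A n z (subst T (quantSV-distinct ∃q (code A) n z≢y) free)

  free2-code⇒free1 : ∀ A z → T (free2 z (code A)) → T (free1 z A)
  free2-code⇒free1 (Ap m (var w) ts) z = from (T-∨ {occT z (var w)}) ∘ inj₂
  free2-code⇒free1 (A ⇒₁ B) z = ∨-mono (free2-code⇒free1 A z) (free2-code⇒free1 B z)
  free2-code⇒free1 (A ∧₁ B) z = ∨-mono (free2-code⇒free1 A z) (free2-code⇒free1 B z)
  free2-code⇒free1 (A ∨₁ B) z = ∨-mono (free2-code⇒free1 A z) (free2-code⇒free1 B z)
  free2-code⇒free1 (∀₁ y A) z = ∧-monoʳ
    (free2-code⇒free1 A z ∘ subst T (free2-block (soVar y) ∀q (arities y (code A)) (code A) z))
  free2-code⇒free1 (∃₁ y A) z = ∧-monoʳ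
    (free2-code⇒free1 A z ∘ subst T (free2-block (soVar y) ∃q (arities y (code A)) (code A) z))

  Agree : (ℕ → Bool) → (ℕ → Bool) → Subst → Form2 → Set
  Agree marked marked′ σ C =
    ∀ n z → T (freeSV n (soVar z n) C) → marked n ≡ marked′ n ⊎ σ z ≡ var z

  Agree-under : ∀ {Q} → SOQuantifier Q → ∀ {marked marked′ σ y C} →
                Agree marked marked′ σ (quantSV Q y C) → Agree marked marked′ (σ [ y ↦ var y ]) C
  Agree-under q {y = y} {C} agree n z free with z ℕ.≟ y
  ... | yes refl rewrite ≡ᵇ-refl z = inj₂ refl
  ... | no z≢y   rewrite ≢⇒≡ᵇ-false z≢y =
    agree n z (subst T (sym (quantSV-distinct q C n z≢y)) free)

  Agree-∨ˡ : ∀ {marked marked′ σ} C D →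
             (∀ n z → T (freeSV n (soVar z n) C ∨ freeSV n (soVar z n) D) →
                      marked n ≡ marked′ n ⊎ σ z ≡ var z) →
             Agree marked marked′ σ C
  Agree-∨ˡ C D agree n z = agree n z ∘ from T-∨ ∘ inj₁

  Agree-∨ʳ : ∀ {marked marked′ σ} C D →
             (∀ n z → T (freeSV n (soVar z n) C ∨ freeSV n (soVar z n) D) →
                      marked n ≡ marked′ n ⊎ σ z ≡ var z) →
             Agree marked marked′ σ D
  Agree-∨ʳ C D agree n z = agree n z ∘ from (T-∨ {freeSV n (soVar z n) C}) ∘ inj₂

  code-psub-cong : ∀ A marked marked′ σ → Agree marked marked′ σ (code A) →
                   code (psub marked σ A) ≡ code (psub marked′ σ A)
  code-psub-cong ⊥₁ _ _ _ _ = refl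
  code-psub-cong (Ap n (var z) ts) marked marked′ σ agree
    with agree n z (from T-≡ (sameSV-refl n (soVar z n)))
  ... | inj₁ same rewrite same = refl
  ... | inj₂ σz with marked n | marked′ n
  ...   | true  | true  = refl
  ...   | false | false = refl
  ...   | true  | false rewrite σz = refl
  ...   | false | true  rewrite σz = refl
  code-psub-cong (Ap n (fun f us) ts) marked marked′ σ _ with marked n | marked′ n
  ... | true  | true  = refl
  ... | false | false = refl
  ... | true  | false = refl
  ... | false | true  = refl
  code-psub-cong (A ⇒₁ B) marked marked′ σ agree = cong₂ _⇒₂_
    (code-psub-cong A marked marked′ σ (Agree-∨ˡ (code A) (code B) agree))
    (code-psub-cong B marked marked′ σ (Agree-∨ʳ (code A) (code B) agree))
  code-psub-cong (A ∧₁ B) marked marked′ σ agree = cong₂ _∧₂_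
    (code-psub-cong A marked marked′ σ (Agree-∨ˡ (code A) (code B) agree))
    (code-psub-cong B marked marked′ σ (Agree-∨ʳ (code A) (code B) agree))
  code-psub-cong (A ∨₁ B) marked marked′ σ agree = cong₂ _∨₂_
    (code-psub-cong A marked marked′ σ (Agree-∨ˡ (code A) (code B) agree))
    (code-psub-cong B marked marked′ σ (Agree-∨ʳ (code A) (code B) agree))
  code-psub-cong (∀₁ y A) marked marked′ σ agree =
    cong (∀ᵢ y ∘ quantSV ∀ₛ y)
         (code-psub-cong A marked marked′ _ (Agree-under ∀q {C = code A} agree))
  code-psub-cong (∃₁ y A) marked marked′ σ agree =
    cong (∃ᵢ y ∘ quantSV ∃ₛ y)
         (code-psub-cong A marked marked′ _ (Agree-under ∃q {C = code A} agree))

  freeFor2-code : ∀ σ A → FreeFor1 σ A → FreeFor2 σ (code A)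
  freeFor2-code σ ⊥₁                   _ = tt
  freeFor2-code σ (Ap n (var z) ts)    _ = tt
  freeFor2-code σ (Ap n (fun f us) ts) _ = tt
  freeFor2-code σ (A ⇒₁ B) (ffA , ffB) = freeFor2-code σ A ffA , freeFor2-code σ B ffB
  freeFor2-code σ (A ∧₁ B) (ffA , ffB) = freeFor2-code σ A ffA , freeFor2-code σ B ffB
  freeFor2-code σ (A ∨₁ B) (ffA , ffB) = freeFor2-code σ A ffA , freeFor2-code σ B ffB
  freeFor2-code σ (∀₁ y A) (ffA , no-capture) =
    freeFor2-block (soVar y) ∀q _ (arities y (code A)) (code A) (freeFor2-code _ A ffA) ,
    λ z → no-capture z ∘ free2-code⇒free1 (∀₁ y A) z
  freeFor2-code σ (∃₁ y A) (ffA , no-capture) =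
    freeFor2-block (soVar y) ∃q _ (arities y (code A)) (code A) (freeFor2-code _ A ffA) ,
    λ z → no-capture z ∘ free2-code⇒free1 (∃₁ y A) z

  headAbs : ∀ n → Term → Abs n
  headAbs n (var y)    = idAbs n (soVar y n)
  headAbs n (fun f us) = ƛ (paramVars n) ⊥₂

  freeFor2-headAbs : ∀ σ n t → FreeFor2 σ (Abs.body (headAbs n t))
  freeFor2-headAbs σ n (var y)    = tt
  freeFor2-headAbs σ n (fun f us) = tt

  freeAbs-headAbs : ∀ n t y → freeAbs y (headAbs n t) ≡ false
  freeAbs-headAbs n (var y′)   y = freeAbs-idAbs n (soVar y′ n) y
  freeAbs-headAbs n (fun f us) y = refl

  freeSV-headAbs-arity : ∀ n t m j → m ≢ n → freeSV m j (Abs.body (headAbs n t)) ≡ false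
  freeSV-headAbs-arity n (var y)    m j m≢n rewrite ≢⇒≡ᵇ-false m≢n = refl
  freeSV-headAbs-arity n (fun f us) m j m≢n = refl

  freeSV-headAbs-soVar : ∀ n t y → T (not (occT y t)) →
                         ∀ m → freeSV m (soVar y m) (Abs.body (headAbs n t)) ≡ false
  freeSV-headAbs-soVar n (var y′)   y y∉t m =
    sameSV-soVar m n λ { refl → subst T (cong not (≡ᵇ-refl y)) y∉t }
  freeSV-headAbs-soVar n (fun f us) y y∉t m = refl

  inst-headAbs-Ap : ∀ {x t σ} n h us → SendsOnly x t σ →
                    inst n (soVar x n) (headAbs n t) (code (Ap n h us)) ≡ code (Ap n (substT σ h) us)
  inst-headAbs-Ap n (fun f vs) us s = refl
  inst-headAbs-Ap {x} {t} {σ} n (var z) us s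
    rewrite inst-SV-same n (soVar x n) (headAbs n t) (soVar z n) us with z ℕ.≟ x
  ... | yes refl rewrite SendsOnly.sends s | ≡ᵇ-refl (soVar z n) = instantiated t
    where
    instantiated : ∀ t → sub2 (argSubst (Abs.params (headAbs n t)) us) (Abs.body (headAbs n t))
                       ≡ code (Ap n t us)
    instantiated (var y)    = cong (SV n (soVar y n)) (argSubst-paramVars n us)
    instantiated (fun f vs) = refl
  ... | no z≢x
    rewrite SendsOnly.only s z z≢x | ≢⇒≡ᵇ-false (z≢x ∘ φ⁻¹-injective n ∘ sym) = refl

  inst-code-Ap-other : ∀ n i (L : Abs n) m h us → n ≢ m →
                       inst n i L (code (Ap m h us)) ≡ code (Ap m h us)
  inst-code-Ap-other n i L m (var z)    us n≢m = inst-SV-other n i L m (soVar z m) us n≢m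
  inst-code-Ap-other n i L m (fun f vs) us n≢m = refl

  freeForAbs-headAbs-Ap : ∀ n i t m h us → FreeForAbs n i (headAbs n t) (code (Ap m h us))
  freeForAbs-headAbs-Ap n i t m (var z)    us =
    freeForAbs-SV n i (headAbs n t) m (soVar z m) us λ σ → freeFor2-headAbs σ n t
  freeForAbs-headAbs-Ap n i t m (fun f vs) us = tt

  headAbs-uncaptured : ∀ {x t σ} n marked y B → y ≢ x → SendsOnly x t σ →
                       (∀ z → T (not (z ≡ᵇ y) ∧ free1 z B) → T (not (occT y (σ z)))) →
                       T (freeSV n (soVar x n) (code (psub marked (σ [ y ↦ var y ]) B))) →
                       ∀ m → freeSV m (soVar y m) (Abs.body (headAbs n t)) ≡ false
  headAbs-uncaptured {x} {t} {σ} n marked y B y≢x s no-capture free =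
    freeSV-headAbs-soVar n t y (subst (λ u → T (not (occT y u))) (SendsOnly.sends s) (no-capture x x-free))
    where
    x-free : T (not (x ≡ᵇ y) ∧ free1 x B)
    x-free rewrite ≢⇒≡ᵇ-false (y≢x ∘ sym) =
      free1-psub⇒free1 marked (MovesOnly-update y (SendsOnly.only s)) B
        (freeSV-code⇒free1 (psub marked (σ [ y ↦ var y ]) B) n x free)

module Translation (S : Signature) (φ : (n : ℕ) → ℕ ↔ ℕ) where
  open Syntax S
  open Coding φ
  open SyntaxProperties S
  open CodingProperties S φ

  module _ {x : ℕ} {t : Term} (n : ℕ) (marked : ℕ → Bool) (unmarked : marked n ≡ false) where

    inst-headAbs-code : ∀ {σ} → SendsOnly x t σ → ∀ A → FreeFor1 σ A →
                        inst n (soVar x n) (headAbs n t) (code (psub marked σ A))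
                        ≡ code (psub (mark n marked) σ A)

    inst-headAbs-quantSV : ∀ {Q} → SOQuantifier Q → ∀ {σ} → SendsOnly x t σ → ∀ y B →
                           FreeFor1 (σ [ y ↦ var y ]) B →
                           (∀ z → T (not (z ≡ᵇ y) ∧ free1 z B) → T (not (occT y (σ z)))) →
                           inst n (soVar x n) (headAbs n t)
                             (quantSV Q y (code (psub marked (σ [ y ↦ var y ]) B)))
                           ≡ quantSV Q y (code (psub (mark n marked) (σ [ y ↦ var y ]) B))
    inst-headAbs-quantSV {Q} q {σ} s y B ffB no-capture with y ℕ.≟ x
    ... | yes refl = begin
      inst n (soVar y n) L (quantSV Q y C)  ≡⟨ inst-notFree n (soVar y n) L _ (quantSV-binds q y C n) ⟩
      quantSV Q y C                         ≡⟨ cong (quantSV Q y) (code-psub-cong B _ _ _ λ _ z _ →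
                                                 inj₂ (MovesOnly-update-self (SendsOnly.only s) z)) ⟩
      quantSV Q y C′                        ∎
      where
      open ≡-Reasoning
      L  = headAbs n t
      C  = code (psub marked (σ [ y ↦ var y ]) B)
      C′ = code (psub (mark n marked) (σ [ y ↦ var y ]) B)
    ... | no y≢x = begin
      inst n i L (block Q (soVar y) (arities y C) C)
        ≡⟨ inst-block (soVar y) q n i L (arities y C) C distinct ⟩
      block Q (soVar y) (arities y C) (inst n i L C)
        ≡⟨ cong (λ l → block Q (soVar y) l (inst n i L C)) same-arities ⟩
      block Q (soVar y) (arities y C′) (inst n i L C)
        ≡⟨ cong (block Q (soVar y) (arities y C′)) body ⟩
      block Q (soVar y) (arities y C′) C′
        ∎
      where
      open ≡-Reasoning
      i  = soVar x n
      L  = headAbs n t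
      C  = code (psub marked (σ [ y ↦ var y ]) B)
      C′ = code (psub (mark n marked) (σ [ y ↦ var y ]) B)
      body : inst n i L C ≡ C′
      body = inst-headAbs-code (SendsOnly-update y≢x s) B ffB
      distinct : ∀ {l} → All (λ m → sameSV n i m (soVar y m) ≡ false) l
      distinct = tabulate λ {m} _ → sameSV-soVar n m (y≢x ∘ sym)
      same-arities : arities y C ≡ arities y C′
      same-arities = trans (arities-cong y C (inst n i L C) invariant) (cong (arities y) body)
        where
        invariant : ∀ m → freeSV m (soVar y m) C ≡ freeSV m (soVar y m) (inst n i L C)
        invariant m with freeSV n i C in free
        ... | false = cong (freeSV m (soVar y m)) (sym (inst-notFree n i L C free))
        ... | true  = sym (freeSV-inst n i L m (soVar y m) C (sameSV-soVar m n y≢x)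
                             (headAbs-uncaptured n marked y B y≢x s no-capture (from T-≡ free) m))

    inst-headAbs-code s ⊥₁ _ = refl
    inst-headAbs-code {σ} s (Ap m h us) _ with m ℕ.≟ n
    ... | no m≢n   rewrite ≢⇒≡ᵇ-false m≢n =
      inst-code-Ap-other n _ (headAbs n t) m _ _ (m≢n ∘ sym)
    ... | yes refl rewrite unmarked | ≡ᵇ-refl m = inst-headAbs-Ap m h (substTs σ us) s
    inst-headAbs-code s (A ⇒₁ B) (ffA , ffB) =
      cong₂ _⇒₂_ (inst-headAbs-code s A ffA) (inst-headAbs-code s B ffB)
    inst-headAbs-code s (A ∧₁ B) (ffA , ffB) =
      cong₂ _∧₂_ (inst-headAbs-code s A ffA) (inst-headAbs-code s B ffB)
    inst-headAbs-code s (A ∨₁ B) (ffA , ffB) =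
      cong₂ _∨₂_ (inst-headAbs-code s A ffA) (inst-headAbs-code s B ffB)
    inst-headAbs-code s (∀₁ y B) (ffB , no-capture) =
      cong (∀ᵢ y) (inst-headAbs-quantSV ∀q s y B ffB no-capture)
    inst-headAbs-code s (∃₁ y B) (ffB , no-capture) =
      cong (∃ᵢ y) (inst-headAbs-quantSV ∃q s y B ffB no-capture)

    freeForAbs-headAbs-code : ∀ {σ} → SendsOnly x t σ → ∀ A → FreeFor1 σ A →
                              FreeForAbs n (soVar x n) (headAbs n t) (code (psub marked σ A))

    freeForAbs-headAbs-quantSV : ∀ {Q} → SOQuantifier Q → ∀ {σ} → SendsOnly x t σ → ∀ y B →
                                 FreeFor1 (σ [ y ↦ var y ]) B →
                                 (∀ z → T (not (z ≡ᵇ y) ∧ free1 z B) → T (not (occT y (σ z)))) →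
                                 FreeForAbs n (soVar x n) (headAbs n t)
                                   (quantSV Q y (code (psub marked (σ [ y ↦ var y ]) B)))
    freeForAbs-headAbs-quantSV {Q} q {σ} s y B ffB no-capture with y ℕ.≟ x
    ... | yes refl = freeForAbs-notFree n (soVar y n) (headAbs n t) (quantSV Q y C) (quantSV-binds q y C n)
      where
      C = code (psub marked (σ [ y ↦ var y ]) B)
    ... | no y≢x = freeForAbs-block (soVar y) q n (soVar x n) (headAbs n t) (arities y C) C
                     (tabulate λ {m} _ → sameSV-soVar n m (y≢x ∘ sym))
                     (tabulate λ {m} _ free → headAbs-uncaptured n marked y B y≢x s no-capture free m)
                     (freeForAbs-headAbs-code (SendsOnly-update y≢x s) B ffB)
      where
      C = code (psub marked (σ [ y ↦ var y ]) B)

    freeForAbs-headAbs-code s ⊥₁ _ = tt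
    freeForAbs-headAbs-code {σ} s (Ap m h us) _ =
      freeForAbs-headAbs-Ap n (soVar x n) t m (if marked m then substT σ h else h) (substTs σ us)
    freeForAbs-headAbs-code s (A ⇒₁ B) (ffA , ffB) =
      freeForAbs-headAbs-code s A ffA , freeForAbs-headAbs-code s B ffB
    freeForAbs-headAbs-code s (A ∧₁ B) (ffA , ffB) =
      freeForAbs-headAbs-code s A ffA , freeForAbs-headAbs-code s B ffB
    freeForAbs-headAbs-code s (A ∨₁ B) (ffA , ffB) =
      freeForAbs-headAbs-code s A ffA , freeForAbs-headAbs-code s B ffB
    freeForAbs-headAbs-code s (∀₁ y B) (ffB , no-capture) =
      freeForAbs-headAbs-quantSV ∀q s y B ffB no-capture , λ _ → from T-not-≡ (freeAbs-headAbs n t y)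
    freeForAbs-headAbs-code s (∃₁ y B) (ffB , no-capture) =
      freeForAbs-headAbs-quantSV ∃q s y B ffB no-capture , λ _ → from T-not-≡ (freeAbs-headAbs n t y)

  module _ {x : ℕ} {t : Term} {σ : Subst} (s : SendsOnly x t σ) (A : Form1) (ffA : FreeFor1 σ A) where

    distinct-arities : ∀ n {l} → All (n ≢_) l →
                       All (λ m → sameSV n (soVar x n) m (soVar x m) ≡ false) l
    distinct-arities n =
      All.map λ {m} n≢m → sameSV-false⁺ n (soVar x n) m (soVar x m) (λ n≡m → ⊥-elim (n≢m n≡m))

    module _ {Q} (q : SOQuantifier Q) (n : ℕ) (marked : ℕ → Bool) (unmarked : marked n ≡ false)
             {l : List ℕ} (n∉l : All (n ≢_) l) where

      freeForAbs-headAbs-block :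
        FreeForAbs n (soVar x n) (headAbs n t) (block Q (soVar x) l (code (psub marked σ A)))
      freeForAbs-headAbs-block =
        freeForAbs-block (soVar x) q n (soVar x n) (headAbs n t) l _ (distinct-arities n n∉l)
          (All.map (λ n≢m _ → freeSV-headAbs-arity n t _ _ (n≢m ∘ sym)) n∉l)
          (freeForAbs-headAbs-code n marked unmarked s A ffA)

      inst-headAbs-block : inst n (soVar x n) (headAbs n t) (block Q (soVar x) l (code (psub marked σ A)))
                         ≡ block Q (soVar x) l (code (psub (mark n marked) σ A))
      inst-headAbs-block =
        trans (inst-block (soVar x) q n (soVar x n) (headAbs n t) l _ (distinct-arities n n∉l))
              (cong (block Q (soVar x) l) (inst-headAbs-code n marked unmarked s A ffA))

    ∀-block-elim-headAbs : ∀ {k Δ} l marked → Unique l → All (λ m → marked m ≡ false) l →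
                 Der2 k Δ (block ∀ₛ (soVar x) l (code (psub marked σ A))) →
                 Der2 k Δ (code (psub (markAll l marked) σ A))
    ∀-block-elim-headAbs []      marked _ _ d = d
    ∀-block-elim-headAbs {k} {Δ} (n ∷ l) marked (n∉l ∷ u) (unmarked ∷ us) d =
      ∀-block-elim-headAbs l (mark n marked) u (mark-unmarked n marked n∉l us)
        (subst (Der2 k Δ) (inst-headAbs-block ∀q n marked unmarked n∉l)
               (∀²E (headAbs n t) (freeForAbs-headAbs-block ∀q n marked unmarked n∉l) d))

    ∃-block-intro-headAbs : ∀ {k Δ} l marked → Unique l → All (λ m → marked m ≡ false) l →
                  Der2 k Δ (code (psub (markAll l marked) σ A)) →
                  Der2 k Δ (block ∃ₛ (soVar x) l (code (psub marked σ A)))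
    ∃-block-intro-headAbs []      marked _ _ d = d
    ∃-block-intro-headAbs {k} {Δ} (n ∷ l) marked (n∉l ∷ u) (unmarked ∷ us) d =
      ∃²I (headAbs n t) (freeForAbs-headAbs-block ∃q n marked unmarked n∉l)
        (subst (Der2 k Δ) (sym (inst-headAbs-block ∃q n marked unmarked n∉l))
               (∃-block-intro-headAbs l (mark n marked) u (mark-unmarked n marked n∉l us) d))

  code-psub-markAll : ∀ x σ A → MovesOnly x σ →
                      code (psub (markAll (arities x (code A)) (λ _ → false)) σ A) ≡ code (sub1 σ A)
  code-psub-markAll x σ A only =
    trans (code-psub-cong A _ (λ _ → true) σ agree) (cong code (psub-all σ A))
    where
    agree : Agree (markAll (arities x (code A)) (λ _ → false)) (λ _ → true) σ (code A)
    agree n z free with z ℕ.≟ x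
    ... | yes refl = inj₁ (markAll-marks (arities z (code A)) _ n (∈-arities⁺ z (code A) n free))
    ... | no z≢x   = inj₂ (only z z≢x)

  sub2-code-quantSV : ∀ {Q} → SOQuantifier Q → ∀ x σ A →
                      sub2 σ (quantSV Q x (code A))
                      ≡ block Q (soVar x) (arities x (code A)) (code (psub (λ _ → false) σ A))
  sub2-code-quantSV {Q} q x σ A =
    trans (sub2-block (soVar x) q σ (arities x (code A)) (code A))
          (cong (block Q (soVar x) (arities x (code A))) (sub2-code σ A))

  code-∀E : ∀ {k Δ x A} t → FreeFor1 (ι [ x ↦ t ]) A →
            Der2 k Δ (code (∀₁ x A)) → Der2 k Δ (code (sub1 (ι [ x ↦ t ]) A))
  code-∀E {k} {Δ} {x} {A} t ffA d =
    subst (Der2 k Δ) (code-psub-markAll x σ A (MovesOnly-[↦] x t))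
      (∀-block-elim-headAbs (SendsOnly-[↦] x t) A ffA l (λ _ → false)
                            (arities-unique x (code A)) (tabulate λ _ → refl)
        (subst (Der2 k Δ) (sub2-code-quantSV ∀q x σ A)
          (∀E t (freeFor2-block (soVar x) ∀q σ l (code A) (freeFor2-code σ A ffA)) d)))
    where
    σ = ι [ x ↦ t ]
    l = arities x (code A)

  code-∃I : ∀ {k Δ x A} t → FreeFor1 (ι [ x ↦ t ]) A →
            Der2 k Δ (code (sub1 (ι [ x ↦ t ]) A)) → Der2 k Δ (code (∃₁ x A))
  code-∃I {k} {Δ} {x} {A} t ffA d =
    ∃I t (freeFor2-block (soVar x) ∃q σ l (code A) (freeFor2-code σ A ffA))
      (subst (Der2 k Δ) (sym (sub2-code-quantSV ∃q x σ A))
        (∃-block-intro-headAbs (SendsOnly-[↦] x t) A ffA l (λ _ → false)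
                               (arities-unique x (code A)) (tabulate λ _ → refl)
          (subst (Der2 k Δ) (sym (code-psub-markAll x σ A (MovesOnly-[↦] x t))) d)))
    where
    σ = ι [ x ↦ t ]
    l = arities x (code A)

  -- The premise CA ⇒ CC is kept available as the assumption U = ∀x ∀X⃗ (CA ⇒ CC) instead of
  -- weakening its derivation under the second-order ∃-eliminations, whose eigenvariable
  -- conditions would not survive weakening.
  module _ {k : Logic} (x : ℕ) (l : List ℕ) (CA CC : Form2) (CC-x : T (not (free2 x CC)))
           (CC-X : ∀ n → T (not (freeSV n (soVar x n) CC))) where

    private
      U : Form2
      U = ∀ᵢ x (block ∀ₛ (soVar x) l (CA ⇒₂ CC))

      U-instance : ∀ {Θ} → U ∈ Θ → Der2 k Θ (CA ⇒₂ CC)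
      U-instance {Θ} u =
        ∀-block-elim-id (soVar x) l (CA ⇒₂ CC)
          (subst (Der2 k Θ) (sub2-id σ≗var (block ∀ₛ (soVar x) l (CA ⇒₂ CC)))
            (∀E (var x) (freeFor2-id σ≗var (block ∀ₛ (soVar x) l (CA ⇒₂ CC))) (ax u)))
        where
        σ≗var : (ι [ x ↦ var x ]) ≗ var
        σ≗var = ≗var-update x (λ _ → refl)

      ∃-block-elim : ∀ l′ {Θ} → block ∃ₛ (soVar x) l′ CA ∈ Θ → U ∈ Θ →
                     (∀ n → n ∈ l′ → NotFreeSVIn2 n (soVar x n) Θ) → Der2 k Θ CC
      ∃-block-elim []       a u _  = ⇒E (U-instance u) (ax a)
      ∃-block-elim (n ∷ l′) a u nf =
        ∃²E (ax a) (∃-block-elim l′ (here refl) (there u) nf′) (nf n (here refl)) (CC-X n)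
        where
        nf′ : ∀ m → m ∈ l′ → NotFreeSVIn2 m (soVar x m) (block ∃ₛ (soVar x) l′ CA ∷ _)
        nf′ m m∈l′ (here refl) = from T-not-≡ (freeSV-block-bound (soVar x) ∃q l′ CA m m∈l′)
        nf′ m m∈l′ (there B∈Θ) = nf m (there m∈l′) B∈Θ

    ∃-quantSV-elim : ∀ {Δ} → NotFreeIn2 x Δ → (∀ n → NotFreeSVIn2 n (soVar x n) Δ) →
                     Der2 k Δ (∃ᵢ x (block ∃ₛ (soVar x) l CA)) → Der2 k (CA ∷ Δ) CC →
                     Der2 k Δ CC
    ∃-quantSV-elim {Δ} nfx nfX d₁ d₂ =
      ⇒E (⇒E (⇒I (⇒I (∃E (ax (there (here refl))) body nfx′ CC-x))) d₁)
         (∀I x nfx (∀-block-intro (soVar x) l nfX (⇒I d₂)))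
      where
      ∃CA = ∃ᵢ x (block ∃ₛ (soVar x) l CA)
      nf : ∀ n → n ∈ l → NotFreeSVIn2 n (soVar x n) (block ∃ₛ (soVar x) l CA ∷ U ∷ ∃CA ∷ Δ)
      nf n n∈l (here refl)                 = from T-not-≡ (freeSV-block-bound _ ∃q l CA n n∈l)
      nf n n∈l (there (here refl))         = from T-not-≡ (freeSV-block-bound _ ∀q l _ n n∈l)
      nf n n∈l (there (there (here refl))) = from T-not-≡ (freeSV-block-bound _ ∃q l CA n n∈l)
      nf n n∈l (there (there (there B∈Δ))) = nfX n B∈Δ
      body : Der2 k (block ∃ₛ (soVar x) l CA ∷ U ∷ ∃CA ∷ Δ) CC
      body = ∃-block-elim l (here refl) (there (here refl)) nf
      nfx′ : NotFreeIn2 x (U ∷ ∃CA ∷ Δ)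
      nfx′ (here refl)         rewrite ≡ᵇ-refl x = tt
      nfx′ (there (here refl)) rewrite ≡ᵇ-refl x = tt
      nfx′ (there (there B∈Δ)) = nfx B∈Δ

  notFree2-code : ∀ {x} Δ → NotFreeIn1 x Δ → NotFreeIn2 x (List.map code Δ)
  notFree2-code {x} Δ nf B∈ with F , F∈Δ , refl ← ∈-map⁻ code B∈ =
    contraposeᵇ (free2-code⇒free1 F x) (nf F∈Δ)

  notFreeSV-code : ∀ {x} Δ → NotFreeIn1 x Δ → ∀ n → NotFreeSVIn2 n (soVar x n) (List.map code Δ)
  notFreeSV-code {x} Δ nf n B∈ with F , F∈Δ , refl ← ∈-map⁻ code B∈ =
    contraposeᵇ (freeSV-code⇒free1 F n x) (nf F∈Δ)

  translate : ∀ {k Δ A} → Der1 k Δ A → Der2 k (List.map code Δ) (code A)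
  translate (ax A∈Δ)    = ax (∈-map⁺ code A∈Δ)
  translate (⊥E d)      = ⊥E (translate d)
  translate (raa c d)   = raa c (translate d)
  translate (⇒I d)      = ⇒I (translate d)
  translate (⇒E d e)    = ⇒E (translate d) (translate e)
  translate (∧I d e)    = ∧I (translate d) (translate e)
  translate (∧E₁ d)     = ∧E₁ (translate d)
  translate (∧E₂ d)     = ∧E₂ (translate d)
  translate (∨I₁ d)     = ∨I₁ (translate d)
  translate (∨I₂ d)     = ∨I₂ (translate d)
  translate (∨E d e f)  = ∨E (translate d) (translate e) (translate f)
  translate {Δ = Δ} (∀I {A = A} x nf d) =
    ∀I x (notFree2-code Δ nf)
      (∀-block-intro (soVar x) (arities x (code A)) (notFreeSV-code Δ nf) (translate d))
  translate (∀E t ff d) = code-∀E t ff (translate d)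
  translate (∃I t ff d) = code-∃I t ff (translate d)
  translate {Δ = Δ} (∃E {A = A} {C = C} {x = x} d e nf nc) =
    ∃-quantSV-elim x (arities x (code A)) (code A) (code C)
      (contraposeᵇ (free2-code⇒free1 C x) nc)
      (λ n → contraposeᵇ (freeSV-code⇒free1 C n x) nc)
      (notFree2-code Δ nf) (notFreeSV-code Δ nf) (translate d) (translate e)

lemma3 : (S : Signature) (φ : (n : ℕ) → ℕ ↔ ℕ) (k : Logic)
         (Γ : Syntax.Form1 S → Set) (A : Syntax.Form1 S) →
         Syntax._⊢¹[_]_ S Γ k A →
         Syntax._⊢²[_]_ S (Syntax.Coding.codeSet S φ Γ) k (Syntax.Coding.code S φ A)
lemma3 S φ k Γ A (Δ , Δ⊆Γ , d) = List.map code Δ , coded-in-Γ , Translation.translate S φ d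
  where
  open Syntax.Coding S φ
  coded-in-Γ : ∀ {B} → B ∈ List.map code Δ → codeSet Γ B
  coded-in-Γ B∈ with F , F∈Δ , B≡F̄ ← ∈-map⁻ code B∈ = F , Δ⊆Γ F∈Δ , B≡F̄
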